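{- Let $G_1$ be a genus of ternary integral quadratic forms such that every form $\tilde f\in G_1$ is equivalent over the $2$-adic integers $\mathbb Z_2$ to $yz-x^2$. Let $n$ be a positive integer, written $n=4^a k$ with $4\nmid k$. Then \[ d_{G_1,2}(n)=\begin{cases} \frac32 & \text{if } k\equiv 7\pmod 8,\\ \frac32-\frac{1}{2^{a+1}} & \text{if } k\equiv 3\pmod 8,\\ \frac32-\frac{3}{2^{a+2}} & \text{if } k\equiv 1,2\pmod 4.\end{cases} \]
   Context: For a ternary form $\tilde f=ax^2+by^2+cz^2+dyz+ezx+fxy$ with integer coefficients, a prime $q$ and an integer $n$, the local ($q$-adic) representation density is $d_{\tilde f,q}(n)=q^{ -2t}\,\#\{(x,y,z)\in(\mathbb Z/q^t\mathbb Z)^3:\tilde f(x,y,z)\equiv n \pmod{q^t}\}$ for all sufficiently large $t$ (this quantity is eventually constant in $t$). It depends only on the $\mathbb Z_q$-equivalence class of $\tilde f$; for a genus $G$, $d_{G,q}(n)$ denotes $d_{\tilde f,q}(n)$ for any $\tilde f\in G$. -}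

module Defs where

open import Data.Nat as ℕ using (ℕ; zero; suc; _^_; _≤_)
open import Data.Nat.Properties using (m^n≢0)
open import Data.Nat.Divisibility using (_∣_; _∣?_)
open import Data.Integer as ℤ using (ℤ; +_; ∣_∣)
open import Data.Rational as ℚ using (ℚ)
open import Data.List using (List; []; _∷_; length; filter; upTo; concatMap; map)
open import Data.Fin using (Fin; zero; suc)
open import Data.Product using (Σ; ∃; _×_; _,_)
open import Relation.Nullary using (¬_)
open import Relation.Binary.PropositionalEquality using (_≡_)

record TForm : Set where
  constructor form
  field
    ca cb cc cd ce cf : ℤ
open TForm public

eval : TForm → ℤ → ℤ → ℤ → ℤ
eval (form a b c d e f) x y z =
  a ℤ.* x ℤ.* x ℤ.+ b ℤ.* y ℤ.* y ℤ.+ c ℤ.* z ℤ.* z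
    ℤ.+ d ℤ.* y ℤ.* z ℤ.+ e ℤ.* z ℤ.* x ℤ.+ f ℤ.* x ℤ.* y

yz-x² : TForm
yz-x² = form (ℤ.- ℤ.1ℤ) ℤ.0ℤ ℤ.0ℤ ℤ.1ℤ ℤ.0ℤ ℤ.0ℤ

_≡_[mod_] : ℤ → ℤ → ℕ → Set
x ≡ y [mod m ] = m ∣ ∣ x ℤ.- y ∣

Mat3 : Set
Mat3 = Fin 3 → Fin 3 → ℤ

det3 : Mat3 → ℤ
det3 M =
  M zero zero ℤ.* (M (suc zero) (suc zero) ℤ.* M (suc (suc zero)) (suc (suc zero))
                   ℤ.- M (suc zero) (suc (suc zero)) ℤ.* M (suc (suc zero)) (suc zero))
  ℤ.- M zero (suc zero) ℤ.* (M (suc zero) zero ℤ.* M (suc (suc zero)) (suc (suc zero))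
                   ℤ.- M (suc zero) (suc (suc zero)) ℤ.* M (suc (suc zero)) zero)
  ℤ.+ M zero (suc (suc zero)) ℤ.* (M (suc zero) zero ℤ.* M (suc (suc zero)) (suc zero)
                   ℤ.- M (suc zero) (suc zero) ℤ.* M (suc (suc zero)) zero)

evalSub : TForm → Mat3 → ℤ → ℤ → ℤ → ℤ
evalSub f M x y z = eval f (row zero) (row (suc zero)) (row (suc (suc zero)))
  where
  row : Fin 3 → ℤ
  row i = M i zero ℤ.* x ℤ.+ M i (suc zero) ℤ.* y ℤ.+ M i (suc (suc zero)) ℤ.* z

-- the form f ∘ M (substitution (x,y,z) ↦ M (x,y,z)), coefficients via the polar form
_∘M_ : TForm → Mat3 → TForm
f ∘M M = form a b c
  (evalSub f M ℤ.0ℤ ℤ.1ℤ ℤ.1ℤ ℤ.- b ℤ.- c)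
  (evalSub f M ℤ.1ℤ ℤ.0ℤ ℤ.1ℤ ℤ.- c ℤ.- a)
  (evalSub f M ℤ.1ℤ ℤ.1ℤ ℤ.0ℤ ℤ.- a ℤ.- b)
  where
  a = evalSub f M ℤ.1ℤ ℤ.0ℤ ℤ.0ℤ
  b = evalSub f M ℤ.0ℤ ℤ.1ℤ ℤ.0ℤ
  c = evalSub f M ℤ.0ℤ ℤ.0ℤ ℤ.1ℤ

_≅_[mod_] : TForm → TForm → ℕ → Set
f ≅ g [mod m ] =
  (ca f ≡ ca g [mod m ]) × (cb f ≡ cb g [mod m ]) × (cc f ≡ cc g [mod m ]) ×
  (cd f ≡ cd g [mod m ]) × (ce f ≡ ce g [mod m ]) × (cf f ≡ cf g [mod m ])

-- Equivalence over ℤ₂: there is M ∈ GL₃(ℤ₂) with f ∘ M = g.  Since ℤ₂ is not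
-- available, we use the (compactness-)equivalent formulation: for every t there is
-- an integer matrix M with odd determinant such that f ∘ M ≡ g (mod 2^t).
Equiv₂ : TForm → TForm → Set
Equiv₂ f g = ∀ (t : ℕ) → ∃ λ (M : Mat3) → (¬ (2 ∣ ∣ det3 M ∣)) × ((f ∘M M) ≅ g [mod 2 ^ t ])

triples : ℕ → List (ℕ × ℕ × ℕ)
triples m = concatMap (λ x → concatMap (λ y → map (λ z → x , y , z) (upTo m)) (upTo m)) (upTo m)

count₂ : TForm → ℤ → ℕ → ℕ
count₂ f n t = length (filter (λ { (x , y , z) → (2 ^ t) ∣? ∣ eval f (+ x) (+ y) (+ z) ℤ.- n ∣ })
                              (triples (2 ^ t)))

ratio₂ : TForm → ℤ → ℕ → ℚ
ratio₂ f n t = ℚ._/_ (+ count₂ f n t) (4 ^ t) {{m^n≢0 4 t}}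

Density₂ : TForm → ℤ → ℚ → Set
Density₂ f n d = ∃ λ (T : ℕ) → ∀ (t : ℕ) → T ≤ t → ratio₂ f n t ≡ d

{-# OPTIONS --safe #-}
-- A substitution with odd determinant permutes (ℤ/2^t)³, so equivalent forms have the
-- same number of solutions mod 2^t and it suffices to count those of yz - x² ≡ n.
-- For odd y the map z ↦ yz - b has odd slope and hence exactly one root mod 2^s; splitting
-- x, y, z by parity this gives N_(t+2)(4n) = 8 N_t(n) + 3·4^(t+1), i.e. d(4n) = d(n)/2 + 3/4,
-- together with the base values d(k) = 3/4, 1, 3/2 for k ≡ 1, 2 (mod 4), k ≡ 3 (mod 8) and
-- k ≡ 7 (mod 8).  Iterating the recursion a times gives the three formulas.

module Submission where

open import Defs

module FiniteSums where

  open import Data.Nat using (ℕ; zero; suc; _+_; _*_; _<_; _≟_; z<s; s<s)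
  open import Data.Nat.Properties
    using (+-identityʳ; +-assoc; *-identityˡ; *-zeroʳ; *-assoc; *-suc; *-distribˡ-+; suc-injective; +-commutativeSemigroup)
  open import Algebra.Properties.CommutativeSemigroup +-commutativeSemigroup using (interchange; x∙yz≈y∙xz)
  open import Function using (_∘_)
  open import Data.Empty using (⊥-elim)
  open import Data.Product using (_×_; _,_)
  open import Data.Product.Properties using (≡-dec)
  open import Relation.Nullary using (¬_; Dec; yes; no)
  open import Relation.Binary.PropositionalEquality

  ∑ : ℕ → (ℕ → ℕ) → ℕ
  ∑ zero    f = 0
  ∑ (suc n) f = f 0 + ∑ n (f ∘ suc)

  syntax ∑ n (λ i → e) = ∑[ i < n ] e

  ∑-cong-< : ∀ n {f g : ℕ → ℕ} → (∀ i → i < n → f i ≡ g i) → ∑ n f ≡ ∑ n g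
  ∑-cong-< zero    eq = refl
  ∑-cong-< (suc n) eq = cong₂ _+_ (eq 0 z<s) (∑-cong-< n (λ i i<n → eq (suc i) (s<s i<n)))

  ∑-cong : ∀ n {f g : ℕ → ℕ} → (∀ i → f i ≡ g i) → ∑ n f ≡ ∑ n g
  ∑-cong n eq = ∑-cong-< n (λ i _ → eq i)

  ∑-const : ∀ n c → ∑[ i < n ] c ≡ n * c
  ∑-const zero    c = refl
  ∑-const (suc n) c = cong (c +_) (∑-const n c)

  ∑-zero : ∀ n → ∑[ i < n ] 0 ≡ 0
  ∑-zero n = trans (∑-const n 0) (*-zeroʳ n)

  ∑-distrib-+ : ∀ n (f g : ℕ → ℕ) → ∑[ i < n ] (f i + g i) ≡ ∑ n f + ∑ n g
  ∑-distrib-+ zero    f g = refl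
  ∑-distrib-+ (suc n) f g = trans (cong (f 0 + g 0 +_) (∑-distrib-+ n (f ∘ suc) (g ∘ suc)))
                                  (interchange (f 0) (g 0) _ _)

  ∑-*ˡ : ∀ n c (f : ℕ → ℕ) → ∑[ i < n ] (c * f i) ≡ c * ∑ n f
  ∑-*ˡ zero    c f = sym (*-zeroʳ c)
  ∑-*ˡ (suc n) c f = trans (cong (c * f 0 +_) (∑-*ˡ n c (f ∘ suc))) (sym (*-distribˡ-+ c (f 0) _))

  ∑-comm : ∀ m n (F : ℕ → ℕ → ℕ) → ∑[ i < m ] ∑[ j < n ] F i j ≡ ∑[ j < n ] ∑[ i < m ] F i j
  ∑-comm zero    n F = sym (∑-zero n)
  ∑-comm (suc m) n F = trans (cong (∑[ j < n ] F 0 j +_) (∑-comm m n (F ∘ suc)))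
                             (sym (∑-distrib-+ n (F 0) (λ j → ∑[ i < m ] F (suc i) j)))

  ∑-+ : ∀ m n (f : ℕ → ℕ) → ∑ (m + n) f ≡ ∑ m f + ∑[ i < n ] f (m + i)
  ∑-+ zero    n f = refl
  ∑-+ (suc m) n f = trans (cong (f 0 +_) (∑-+ m n (f ∘ suc))) (sym (+-assoc (f 0) _ _))

  ∑-even-odd : ∀ m (f : ℕ → ℕ) → ∑ (2 * m) f ≡ ∑[ i < m ] f (2 * i) + ∑[ i < m ] f (suc (2 * i))
  ∑-even-odd zero    f = refl
  ∑-even-odd (suc m) f = begin
    ∑ (2 * suc m) f                         ≡⟨ cong (λ k → ∑ k f) (*-suc 2 m) ⟩
    f 0 + (f 1 + ∑ (2 * m) (f ∘ (2 +_)))    ≡⟨ cong (λ s → f 0 + (f 1 + s)) (∑-even-odd m (f ∘ (2 +_))) ⟩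
    f 0 + (f 1 + (E + O))                   ≡⟨ cong (f 0 +_) (x∙yz≈y∙xz (f 1) E O) ⟩
    f 0 + (E + (f 1 + O))                   ≡⟨ sym (+-assoc (f 0) E _) ⟩
    f 0 + E + (f 1 + O)                     ≡⟨ cong₂ (λ e o → f 0 + e + (f 1 + o)) (shift (λ k → k)) (shift suc) ⟩
    ∑[ i < suc m ] f (2 * i) + ∑[ i < suc m ] f (suc (2 * i)) ∎
    where
    open ≡-Reasoning
    E = ∑[ i < m ] f (2 + 2 * i)
    O = ∑[ i < m ] f (suc (2 + 2 * i))
    shift : (g : ℕ → ℕ) → ∑[ i < m ] f (g (2 + 2 * i)) ≡ ∑[ i < m ] f (g (2 * suc i))
    shift g = ∑-cong m (λ i → cong (f ∘ g) (sym (*-suc 2 i)))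

  ∑-periodic : ∀ m (f : ℕ → ℕ) → (∀ i → f (m + i) ≡ f i) → ∑ (2 * m) f ≡ 2 * ∑ m f
  ∑-periodic m f per = begin
    ∑ (m + (m + 0)) f                 ≡⟨ cong (λ k → ∑ (m + k) f) (+-identityʳ m) ⟩
    ∑ (m + m) f                       ≡⟨ ∑-+ m m f ⟩
    ∑ m f + ∑[ i < m ] f (m + i)      ≡⟨ cong (∑ m f +_) (∑-cong m per) ⟩
    ∑ m f + ∑ m f                     ≡⟨ cong (∑ m f +_) (sym (+-identityʳ _)) ⟩
    2 * ∑ m f                         ∎
    where open ≡-Reasoning

  ∑³ : ℕ → (ℕ → ℕ → ℕ → ℕ) → ℕ
  ∑³ m G = ∑[ x < m ] ∑[ y < m ] ∑[ z < m ] G x y z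

  ∑³-cong : ∀ m {G G′ : ℕ → ℕ → ℕ → ℕ} → (∀ x y z → x < m → y < m → z < m → G x y z ≡ G′ x y z) → ∑³ m G ≡ ∑³ m G′
  ∑³-cong m eq = ∑-cong-< m λ x x<m → ∑-cong-< m λ y y<m → ∑-cong-< m λ z z<m → eq x y z x<m y<m z<m

  ∑³-periodic : ∀ m (G : ℕ → ℕ → ℕ → ℕ) →
    (∀ x y z → G (m + x) y z ≡ G x y z) → (∀ x y z → G x (m + y) z ≡ G x y z) →
    (∀ x y z → G x y (m + z) ≡ G x y z) → ∑³ (2 * m) G ≡ 8 * ∑³ m G
  ∑³-periodic m G px py pz = begin
    ∑³ (2 * m) G
      ≡⟨ ∑-periodic m _ (λ x → ∑-cong (2 * m) (λ y → ∑-cong (2 * m) (px x y))) ⟩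
    2 * ∑[ x < m ] ∑[ y < 2 * m ] ∑[ z < 2 * m ] G x y z
      ≡⟨ cong (2 *_) (∑-cong m (λ x → ∑-periodic m _ (λ y → ∑-cong (2 * m) (py x y)))) ⟩
    2 * ∑[ x < m ] (2 * ∑[ y < m ] ∑[ z < 2 * m ] G x y z)
      ≡⟨ cong (2 *_) (∑-cong m (λ x → cong (2 *_) (∑-cong m (λ y → ∑-periodic m _ (pz x y))))) ⟩
    2 * ∑[ x < m ] (2 * ∑[ y < m ] (2 * ∑[ z < m ] G x y z))
      ≡⟨ cong (2 *_) (∑-cong m (λ x → cong (2 *_) (∑-*ˡ m 2 _))) ⟩
    2 * ∑[ x < m ] (2 * (2 * ∑[ y < m ] ∑[ z < m ] G x y z))
      ≡⟨ cong (2 *_) (trans (∑-cong m (λ x → sym (*-assoc 2 2 (∑[ y < m ] ∑[ z < m ] G x y z)))) (∑-*ˡ m 4 _)) ⟩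
    2 * (4 * ∑³ m G)
      ≡⟨ sym (*-assoc 2 4 (∑³ m G)) ⟩
    8 * ∑³ m G ∎
    where open ≡-Reasoning

  ∑³-rotate : ∀ m (G : ℕ → ℕ → ℕ → ℕ) → ∑³ m G ≡ ∑[ y < m ] ∑[ z < m ] ∑[ x < m ] G x y z
  ∑³-rotate m G = trans (∑-comm m m _) (∑-cong m (λ y → ∑-comm m m (λ x z → G x y z)))

  𝟙 : {P : Set} → Dec P → ℕ
  𝟙 (yes _) = 1
  𝟙 (no _)  = 0

  𝟙-yes : ∀ {P : Set} (p? : Dec P) → P → 𝟙 p? ≡ 1
  𝟙-yes (yes _) _ = refl
  𝟙-yes (no ¬p) p = ⊥-elim (¬p p)

  𝟙-no : ∀ {P : Set} (p? : Dec P) → ¬ P → 𝟙 p? ≡ 0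
  𝟙-no (yes p) ¬p = ⊥-elim (¬p p)
  𝟙-no (no _)  _  = refl

  𝟙-cong : ∀ {P Q : Set} (p? : Dec P) (q? : Dec Q) → (P → Q) → (Q → P) → 𝟙 p? ≡ 𝟙 q?
  𝟙-cong (yes p) q?      p⇒q _   = sym (𝟙-yes q? (p⇒q p))
  𝟙-cong (no ¬p) q?      _   q⇒p = sym (𝟙-no q? (λ q → ¬p (q⇒p q)))

  ∑-select : ∀ m a (h : ℕ → ℕ) → a < m → ∑[ x < m ] (𝟙 (x ≟ a) * h x) ≡ h a
  ∑-select (suc m) zero    h _ = begin
    1 * h 0 + ∑[ x < m ] (𝟙 (suc x ≟ 0) * h (suc x))
      ≡⟨ cong₂ _+_ (*-identityˡ (h 0)) (∑-cong m (λ x → cong (_* h (suc x)) (𝟙-no (suc x ≟ 0) (λ ())))) ⟩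
    h 0 + ∑[ x < m ] 0  ≡⟨ cong (h 0 +_) (∑-zero m) ⟩
    h 0 + 0             ≡⟨ +-identityʳ (h 0) ⟩
    h 0 ∎
    where open ≡-Reasoning
  ∑-select (suc m) (suc a) h (s<s a<m) = begin
    𝟙 (0 ≟ suc a) * h 0 + ∑[ x < m ] (𝟙 (suc x ≟ suc a) * h (suc x))
      ≡⟨ cong₂ _+_ (cong (_* h 0) (𝟙-no (0 ≟ suc a) (λ ())))
                   (∑-cong m (λ x → cong (_* h (suc x)) (𝟙-cong (suc x ≟ suc a) (x ≟ a) suc-injective (cong suc)))) ⟩
    ∑[ x < m ] (𝟙 (x ≟ a) * h (suc x))
      ≡⟨ ∑-select m a (h ∘ suc) a<m ⟩
    h (suc a) ∎
    where open ≡-Reasoning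

  Triple : Set
  Triple = ℕ × ℕ × ℕ

  InRange : ℕ → Triple → Set
  InRange m (x , y , z) = x < m × y < m × z < m

  δ³ : Triple → Triple → ℕ
  δ³ (x , y , z) (a , b , c) = 𝟙 (x ≟ a) * (𝟙 (y ≟ b) * 𝟙 (z ≟ c))

  δ³-refl : ∀ u → δ³ u u ≡ 1
  δ³-refl (a , b , c) rewrite 𝟙-yes (a ≟ a) refl | 𝟙-yes (b ≟ b) refl | 𝟙-yes (c ≟ c) refl = refl

  δ³-≢ : ∀ v u → ¬ v ≡ u → δ³ v u ≡ 0
  δ³-≢ (x , y , z) (a , b , c) v≢u with x ≟ a | y ≟ b | z ≟ c
  ... | yes refl | yes refl | yes refl = ⊥-elim (v≢u refl)
  ... | no _     | _        | _        = refl
  ... | yes _    | no _     | _        = refl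
  ... | yes _    | yes _    | no _     = refl

  ∑³-select : ∀ m (H : Triple → ℕ) u → InRange m u → ∑³ m (λ x y z → δ³ (x , y , z) u * H (x , y , z)) ≡ H u
  ∑³-select m H (a , b , c) (a<m , b<m , c<m) = begin
    ∑[ x < m ] ∑[ y < m ] ∑[ z < m ] (𝟙 (x ≟ a) * (𝟙 (y ≟ b) * 𝟙 (z ≟ c)) * H (x , y , z))
      ≡⟨ ∑-cong m (λ x → trans (∑-cong m (λ y → trans (∑-cong m (λ z → regroup (𝟙 (x ≟ a)) (𝟙 (y ≟ b)) (𝟙 (z ≟ c)) _))
                                                         (trans (∑-*ˡ m (𝟙 (x ≟ a)) _) (cong (𝟙 (x ≟ a) *_) (∑-*ˡ m (𝟙 (y ≟ b)) _)))))
                               (∑-*ˡ m (𝟙 (x ≟ a)) _)) ⟩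
    ∑[ x < m ] (𝟙 (x ≟ a) * ∑[ y < m ] (𝟙 (y ≟ b) * ∑[ z < m ] (𝟙 (z ≟ c) * H (x , y , z))))
      ≡⟨ ∑-select m a _ a<m ⟩
    ∑[ y < m ] (𝟙 (y ≟ b) * ∑[ z < m ] (𝟙 (z ≟ c) * H (a , y , z)))
      ≡⟨ ∑-select m b _ b<m ⟩
    ∑[ z < m ] (𝟙 (z ≟ c) * H (a , b , z))
      ≡⟨ ∑-select m c _ c<m ⟩
    H (a , b , c) ∎
    where
    open ≡-Reasoning
    regroup : ∀ p q r h → p * (q * r) * h ≡ p * (q * (r * h))
    regroup p q r h = trans (*-assoc p (q * r) h) (cong (p *_) (*-assoc q r h))

  ∑-∑³ : ∀ n m (G : ℕ → ℕ → ℕ → ℕ → ℕ) → ∑[ i < n ] ∑³ m (G i) ≡ ∑³ m (λ x y z → ∑[ i < n ] G i x y z)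
  ∑-∑³ n m G = trans (∑-comm n m _) (∑-cong m (λ x → trans (∑-comm n m _) (∑-cong m (λ y → ∑-comm n m _))))

  ∑³-comm : ∀ m (F : Triple → Triple → ℕ) →
    ∑³ m (λ x y z → ∑³ m (λ a b c → F (x , y , z) (a , b , c))) ≡ ∑³ m (λ a b c → ∑³ m (λ x y z → F (x , y , z) (a , b , c)))
  ∑³-comm m F = begin
    ∑[ x < m ] ∑[ y < m ] ∑[ z < m ] ∑³ m (λ a b c → F (x , y , z) (a , b , c))
      ≡⟨ ∑-cong m (λ x → ∑-cong m (λ y → ∑-∑³ m m (λ z a b c → F (x , y , z) (a , b , c)))) ⟩
    ∑[ x < m ] ∑[ y < m ] ∑³ m (λ a b c → ∑[ z < m ] F (x , y , z) (a , b , c))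
      ≡⟨ ∑-cong m (λ x → ∑-∑³ m m _) ⟩
    ∑[ x < m ] ∑³ m (λ a b c → ∑[ y < m ] ∑[ z < m ] F (x , y , z) (a , b , c))
      ≡⟨ ∑-∑³ m m _ ⟩
    ∑³ m (λ a b c → ∑³ m (λ x y z → F (x , y , z) (a , b , c))) ∎
    where open ≡-Reasoning

  -- Write H (φ v) as ∑_w δ(w, φ v) H w and exchange the sums; for w in range, w = φ v iff v = ψ w.
  ∑³-bijection : ∀ m (H : Triple → ℕ) (φ ψ : Triple → Triple) →
    (∀ v → InRange m (φ v)) → (∀ w → InRange m (ψ w)) →
    (∀ v → InRange m v → ψ (φ v) ≡ v) → (∀ w → InRange m w → φ (ψ w) ≡ w) →
    ∑³ m (λ x y z → H (φ (x , y , z))) ≡ ∑³ m (λ x y z → H (x , y , z))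
  ∑³-bijection m H φ ψ φ-in ψ-in ψφ φψ = begin
    ∑³ m (λ x y z → H (φ (x , y , z)))
      ≡⟨ ∑³-cong m (λ x y z _ _ _ → sym (∑³-select m H (φ (x , y , z)) (φ-in _))) ⟩
    ∑³ m (λ x y z → ∑³ m (λ a b c → δ³ (a , b , c) (φ (x , y , z)) * H (a , b , c)))
      ≡⟨ ∑³-comm m (λ v w → δ³ w (φ v) * H w) ⟩
    ∑³ m (λ a b c → ∑³ m (λ x y z → δ³ (a , b , c) (φ (x , y , z)) * H (a , b , c)))
      ≡⟨ ∑³-cong m (λ a b c a< b< c< → ∑³-cong m (λ x y z x< y< z< →
           cong (_* H (a , b , c)) (swap (x , y , z) (a , b , c) (x< , y< , z<) (a< , b< , c<)))) ⟩
    ∑³ m (λ a b c → ∑³ m (λ x y z → δ³ (x , y , z) (ψ (a , b , c)) * H (a , b , c)))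
      ≡⟨ ∑³-cong m (λ a b c _ _ _ → ∑³-select m (λ _ → H (a , b , c)) (ψ (a , b , c)) (ψ-in _)) ⟩
    ∑³ m (λ a b c → H (a , b , c)) ∎
    where
    open ≡-Reasoning
    swap : ∀ v w → InRange m v → InRange m w → δ³ w (φ v) ≡ δ³ v (ψ w)
    swap v w v-in w-in with ≡-dec _≟_ (≡-dec _≟_ _≟_) v (ψ w)
    ... | yes refl = trans (cong (δ³ w) (φψ w w-in)) (trans (δ³-refl w) (sym (δ³-refl (ψ w))))
    ... | no v≢ψw  = trans (δ³-≢ w (φ v) (λ w≡φv → v≢ψw (trans (sym (ψφ v v-in)) (cong ψ (sym w≡φv)))))
                           (sym (δ³-≢ v (ψ w) v≢ψw))

open FiniteSums

module Congruences where

  open import Data.Nat as ℕ using (ℕ)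
  import Data.Nat.Divisibility as ℕ
  open import Data.Integer using (ℤ; +_; -_; _+_; _-_; _*_; ∣_∣; 0ℤ)
  open import Data.Integer.Properties using (∣-i∣≡∣i∣; abs-*; +-inverseʳ; pos-+)
  open import Data.Integer.Divisibility.Signed
    using (_∣_; ∣ᵤ⇒∣; ∣⇒∣ᵤ; ∣-refl; ∣m⇒∣-m; ∣m∣n⇒∣m+n; ∣m∣n⇒∣m-n; ∣m+n∣m⇒∣n; ∣m⇒∣m*n; ∣n⇒∣m*n)
  open import Data.Integer.Tactic.RingSolver using (solve-∀)
  open import Relation.Nullary using (¬_)
  open import Relation.Binary.PropositionalEquality

  -- A record rather than a definition like _≡_[mod_] (which unfolds to q ∣ ∣ a - b ∣),
  -- so that Agda can infer a and b from a proof.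
  record _≈_[mod_] (a b : ℤ) (q : ℕ) : Set where
    constructor ≈-mod
    field divides-difference : + q ∣ a - b
  open _≈_[mod_] public

  ≡-mod⇒≈ : ∀ {q} a b → a ≡ b [mod q ] → a ≈ b [mod q ]
  ≡-mod⇒≈ _ _ q∣a-b = ≈-mod (∣ᵤ⇒∣ q∣a-b)

  private
    ring₁ : ∀ a b → - (a - b) ≡ b - a
    ring₁ = solve-∀
    ring₂ : ∀ a b c → (a - b) + (b - c) ≡ a - c
    ring₂ = solve-∀
    ring₃ : ∀ a b c d → (a - b) + (c - d) ≡ (a + c) - (b + d)
    ring₃ = solve-∀
    ring₄ : ∀ a b c d → (a - b) * c + b * (c - d) ≡ a * c - b * d
    ring₄ = solve-∀
    ring₅ : ∀ a b → - (a - b) ≡ - a - - b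
    ring₅ = solve-∀
    ring₆ : ∀ m x → m + x - x ≡ m
    ring₆ = solve-∀
    ring₇ : ∀ a b → a - (a - b) ≡ b
    ring₇ = solve-∀
    ring₈ : ∀ a b → (a - b) + b ≡ a
    ring₈ = solve-∀

  ≈-reflexive : ∀ {q a b} → a ≡ b → a ≈ b [mod q ]
  ≈-reflexive {q} {a} refl = ≈-mod (subst (+ q ∣_) (sym (+-inverseʳ a)) (∣n⇒∣m*n 0ℤ ∣-refl))

  ≈-refl : ∀ {q} a → a ≈ a [mod q ]
  ≈-refl a = ≈-reflexive refl

  ≈-sym : ∀ {q a b} → a ≈ b [mod q ] → b ≈ a [mod q ]
  ≈-sym {q} {a} {b} (≈-mod p) = ≈-mod (subst (+ q ∣_) (ring₁ a b) (∣m⇒∣-m p))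

  ≈-trans : ∀ {q a b c} → a ≈ b [mod q ] → b ≈ c [mod q ] → a ≈ c [mod q ]
  ≈-trans {q} {a} {b} {c} (≈-mod p) (≈-mod r) = ≈-mod (subst (+ q ∣_) (ring₂ a b c) (∣m∣n⇒∣m+n p r))

  ≈-+ : ∀ {q a b c d} → a ≈ b [mod q ] → c ≈ d [mod q ] → (a + c) ≈ (b + d) [mod q ]
  ≈-+ {q} {a} {b} {c} {d} (≈-mod p) (≈-mod r) = ≈-mod (subst (+ q ∣_) (ring₃ a b c d) (∣m∣n⇒∣m+n p r))

  ≈-* : ∀ {q a b c d} → a ≈ b [mod q ] → c ≈ d [mod q ] → (a * c) ≈ (b * d) [mod q ]
  ≈-* {q} {a} {b} {c} {d} (≈-mod p) (≈-mod r) =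
    ≈-mod (subst (+ q ∣_) (ring₄ a b c d) (∣m∣n⇒∣m+n (∣m⇒∣m*n c p) (∣n⇒∣m*n b r)))

  ≈-neg : ∀ {q a b} → a ≈ b [mod q ] → (- a) ≈ (- b) [mod q ]
  ≈-neg {q} {a} {b} (≈-mod p) = ≈-mod (subst (+ q ∣_) (ring₅ a b) (∣m⇒∣-m p))

  +[m+x]≈+x : ∀ m x → (+ (m ℕ.+ x)) ≈ (+ x) [mod m ]
  +[m+x]≈+x m x = ≈-mod (subst (+ m ∣_) (sym (trans (cong (_- + x) (pos-+ m x)) (ring₆ (+ m) (+ x)))) ∣-refl)

  𝟙[_∣_] : ℕ → ℤ → ℕ
  𝟙[ q ∣ c ] = 𝟙 (q ℕ.∣? ∣ c ∣)

  𝟙∣-cong : ∀ {q a b} → a ≈ b [mod q ] → 𝟙[ q ∣ a ] ≡ 𝟙[ q ∣ b ]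
  𝟙∣-cong {q} {a} {b} (≈-mod q∣a-b) = 𝟙-cong (q ℕ.∣? ∣ a ∣) (q ℕ.∣? ∣ b ∣)
    (λ q∣a → ∣⇒∣ᵤ (subst (+ q ∣_) (ring₇ a b) (∣m∣n⇒∣m-n (∣ᵤ⇒∣ {+ q} {a} q∣a) q∣a-b)))
    (λ q∣b → ∣⇒∣ᵤ (subst (+ q ∣_) (ring₈ a b) (∣m∣n⇒∣m+n q∣a-b (∣ᵤ⇒∣ {+ q} {b} q∣b))))

  𝟙∣-neg : ∀ q c → 𝟙[ q ∣ - c ] ≡ 𝟙[ q ∣ c ]
  𝟙∣-neg q c rewrite ∣-i∣≡∣i∣ c = refl

  𝟙[1∣] : ∀ c → 𝟙[ 1 ∣ c ] ≡ 1
  𝟙[1∣] c = 𝟙-yes (1 ℕ.∣? ∣ c ∣) (ℕ.1∣ ∣ c ∣)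

  𝟙∣-*2 : ∀ q d → 𝟙[ 2 ℕ.* q ∣ + 2 * d ] ≡ 𝟙[ q ∣ d ]
  𝟙∣-*2 q d rewrite abs-* (+ 2) d =
    𝟙-cong (2 ℕ.* q ℕ.∣? 2 ℕ.* ∣ d ∣) (q ℕ.∣? ∣ d ∣) (ℕ.*-cancelˡ-∣ 2) (ℕ.*-monoʳ-∣ 2)

  𝟙∣-even : ∀ q {c d} → c ≡ + 2 * d → 𝟙[ 2 ℕ.* q ∣ c ] ≡ 𝟙[ q ∣ d ]
  𝟙∣-even q {d = d} refl = 𝟙∣-*2 q d

  𝟙∣-odd : ∀ q {c} d → c ≡ + 2 * d + + 1 → 𝟙[ 2 ℕ.* q ∣ c ] ≡ 0
  𝟙∣-odd q d refl = 𝟙-no (2 ℕ.* q ℕ.∣? ∣ + 2 * d + + 1 ∣) λ 2q∣c →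
    2≢1 (ℕ.∣1⇒≡1 (∣⇒∣ᵤ {+ 2} {+ 1} (∣m+n∣m⇒∣n (∣ᵤ⇒∣ {+ 2} {+ 2 * d + + 1} (ℕ.∣-trans (ℕ.m∣m*n q) 2q∣c))
                                               (∣m⇒∣m*n d (∣-refl {+ 2})))))
    where
    2≢1 : ¬ 2 ≡ 1
    2≢1 ()

open Congruences

module ParitySplitting where

  open import Data.Nat as ℕ using (ℕ; suc; _<_; s≤s)
  open import Data.Integer using (ℤ; +_; _+_; _*_)
  open import Data.Integer.Properties using (pos-*; pos-+; +-comm)
  open import Data.Integer.DivMod using (_%ℕ_; _/ℕ_; n%ℕd<d; a≡a%ℕn+[a/ℕn]*n)
  open import Data.Integer.Tactic.RingSolver using (solve-∀)
  open import Relation.Binary.PropositionalEquality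

  data Parity : ℤ → Set where
    even : ∀ c → Parity (+ 2 * c)
    odd  : ∀ c → Parity (+ 2 * c + + 1)

  parity : ∀ b → Parity b
  parity b = by-remainder (b %ℕ 2) (n%ℕd<d b 2) (a≡a%ℕn+[a/ℕn]*n b 2)
    where
    q = b /ℕ 2
    ring₀ : ∀ q → + 0 + q * + 2 ≡ + 2 * q
    ring₀ = solve-∀
    ring₁ : ∀ q → + 1 + q * + 2 ≡ + 2 * q + + 1
    ring₁ = solve-∀
    by-remainder : ∀ r → r < 2 → b ≡ + r + q * + 2 → Parity b
    by-remainder 0             _              eq = subst Parity (sym (trans eq (ring₀ q))) (even q)
    by-remainder 1             _              eq = subst Parity (sym (trans eq (ring₁ q))) (odd q)
    by-remainder (suc (suc r)) (s≤s (s≤s ())) _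

  ∑-even-odd-ℤ : ∀ m (g : ℤ → ℕ) →
    ∑[ x < 2 ℕ.* m ] g (+ x) ≡ ∑[ i < m ] g (+ 2 * + i) ℕ.+ ∑[ i < m ] g (+ 2 * + i + + 1)
  ∑-even-odd-ℤ m g = trans (∑-even-odd m (λ x → g (+ x)))
    (cong₂ ℕ._+_ (∑-cong m (λ i → cong g (pos-* 2 i))) (∑-cong m (λ i → cong g (+[1+2i] i))))
    where
    +[1+2i] : ∀ i → + suc (2 ℕ.* i) ≡ + 2 * + i + + 1
    +[1+2i] i = trans (pos-+ 1 (2 ℕ.* i)) (trans (+-comm (+ 1) (+ (2 ℕ.* i))) (cong (_+ + 1) (pos-* 2 i)))

  ∑²-even-odd-ℤ : ∀ m (F : ℤ → ℤ → ℕ) → ∑[ y < 2 ℕ.* m ] ∑[ z < 2 ℕ.* m ] F (+ y) (+ z) ≡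
    (∑[ a < m ] ∑[ b < m ] F (+ 2 * + a) (+ 2 * + b) ℕ.+ ∑[ a < m ] ∑[ b < m ] F (+ 2 * + a) (+ 2 * + b + + 1))
    ℕ.+ (∑[ a < m ] ∑[ b < m ] F (+ 2 * + a + + 1) (+ 2 * + b) ℕ.+ ∑[ a < m ] ∑[ b < m ] F (+ 2 * + a + + 1) (+ 2 * + b + + 1))
  ∑²-even-odd-ℤ m F = trans (∑-even-odd-ℤ m (λ y → ∑[ z < 2 ℕ.* m ] F y (+ z)))
    (cong₂ ℕ._+_ (split (λ a → + 2 * + a)) (split (λ a → + 2 * + a + + 1)))
    where
    split : ∀ (y : ℕ → ℤ) → ∑[ a < m ] ∑[ z < 2 ℕ.* m ] F (y a) (+ z) ≡
                            ∑[ a < m ] ∑[ b < m ] F (y a) (+ 2 * + b) ℕ.+ ∑[ a < m ] ∑[ b < m ] F (y a) (+ 2 * + b + + 1)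
    split y = trans (∑-cong m (λ a → ∑-even-odd-ℤ m (F (y a)))) (∑-distrib-+ m _ _)

  ∑-by-parity : ∀ m (g : ℤ → ℕ) e o → (∀ i → g (+ 2 * + i) ≡ e) → (∀ i → g (+ 2 * + i + + 1) ≡ o) →
                ∑[ x < 2 ℕ.* m ] g (+ x) ≡ m ℕ.* e ℕ.+ m ℕ.* o
  ∑-by-parity m g e o even≡e odd≡o = trans (∑-even-odd-ℤ m g)
    (cong₂ ℕ._+_ (trans (∑-cong m even≡e) (∑-const m e)) (trans (∑-cong m odd≡o) (∑-const m o)))

open ParitySplitting

module OddSlopeRoots where

  open import Data.Nat as ℕ using (zero; suc; _^_)
  open import Data.Nat.Properties using (+-identityʳ)
  open import Data.Integer using (ℤ; +_; _+_; _*_)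
  open import Data.Integer.Tactic.RingSolver using (solve-∀)
  open import Relation.Binary.PropositionalEquality

  oddSlope : ℤ → ℤ → ℤ → ℤ → ℤ
  oddSlope a u b x = + 2 * a * x * x + (+ 2 * u + + 1) * x + b

  oddSlope-root-count : ∀ r a u b → ∑[ x < 2 ^ r ] 𝟙[ 2 ^ r ∣ oddSlope a u b (+ x) ] ≡ 1
  oddSlope-root-count zero    a u b = trans (+-identityʳ _) (𝟙[1∣] (oddSlope a u b (+ 0)))
  oddSlope-root-count (suc r) a u b with parity b
  ... | even c = begin
    ∑[ x < 2 ^ suc r ] 𝟙[ 2 ^ suc r ∣ oddSlope a u (+ 2 * c) (+ x) ]
      ≡⟨ ∑-even-odd-ℤ (2 ^ r) (λ x → 𝟙[ 2 ^ suc r ∣ oddSlope a u (+ 2 * c) x ]) ⟩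
    ∑[ i < 2 ^ r ] 𝟙[ 2 ^ suc r ∣ oddSlope a u (+ 2 * c) (+ 2 * + i) ]
      ℕ.+ ∑[ i < 2 ^ r ] 𝟙[ 2 ^ suc r ∣ oddSlope a u (+ 2 * c) (+ 2 * + i + + 1) ]
      ≡⟨ cong₂ ℕ._+_ (∑-cong (2 ^ r) (λ i → 𝟙∣-even (2 ^ r) (even-even a u c (+ i))))
                     (∑-cong (2 ^ r) (λ i → 𝟙∣-odd (2 ^ r) (+ 4 * a * + i * + i + (+ 4 * a + + 2 * u + + 1) * + i + a + u + c)
                                                        (even-odd a u c (+ i)))) ⟩
    ∑[ i < 2 ^ r ] 𝟙[ 2 ^ r ∣ oddSlope (+ 2 * a) u c (+ i) ] ℕ.+ ∑[ i < 2 ^ r ] 0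
      ≡⟨ cong₂ ℕ._+_ (oddSlope-root-count r (+ 2 * a) u c) (∑-zero (2 ^ r)) ⟩
    1 ∎
    where
    open ≡-Reasoning
    -- The solver cannot unfold oddSlope, so these identities restate it as a let-bound P.
    even-even : ∀ a u c i → let P a u b x = + 2 * a * x * x + (+ 2 * u + + 1) * x + b in
      P a u (+ 2 * c) (+ 2 * i) ≡ + 2 * P (+ 2 * a) u c i
    even-even = solve-∀
    even-odd : ∀ a u c i → let P a u b x = + 2 * a * x * x + (+ 2 * u + + 1) * x + b in
      P a u (+ 2 * c) (+ 2 * i + + 1) ≡ + 2 * (+ 4 * a * i * i + (+ 4 * a + + 2 * u + + 1) * i + a + u + c) + + 1
    even-odd = solve-∀
  ... | odd c = begin
    ∑[ x < 2 ^ suc r ] 𝟙[ 2 ^ suc r ∣ oddSlope a u (+ 2 * c + + 1) (+ x) ]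
      ≡⟨ ∑-even-odd-ℤ (2 ^ r) (λ x → 𝟙[ 2 ^ suc r ∣ oddSlope a u (+ 2 * c + + 1) x ]) ⟩
    ∑[ i < 2 ^ r ] 𝟙[ 2 ^ suc r ∣ oddSlope a u (+ 2 * c + + 1) (+ 2 * + i) ]
      ℕ.+ ∑[ i < 2 ^ r ] 𝟙[ 2 ^ suc r ∣ oddSlope a u (+ 2 * c + + 1) (+ 2 * + i + + 1) ]
      ≡⟨ cong₂ ℕ._+_ (∑-cong (2 ^ r) (λ i → 𝟙∣-odd (2 ^ r) (+ 4 * a * + i * + i + (+ 2 * u + + 1) * + i + c) (odd-even a u c (+ i))))
                     (∑-cong (2 ^ r) (λ i → 𝟙∣-even (2 ^ r) (odd-odd a u c (+ i)))) ⟩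
    ∑[ i < 2 ^ r ] 0 ℕ.+ ∑[ i < 2 ^ r ] 𝟙[ 2 ^ r ∣ oddSlope (+ 2 * a) (+ 2 * a + u) (a + u + c + + 1) (+ i) ]
      ≡⟨ cong₂ ℕ._+_ (∑-zero (2 ^ r)) (oddSlope-root-count r (+ 2 * a) (+ 2 * a + u) (a + u + c + + 1)) ⟩
    1 ∎
    where
    open ≡-Reasoning
    odd-even : ∀ a u c i → let P a u b x = + 2 * a * x * x + (+ 2 * u + + 1) * x + b in
      P a u (+ 2 * c + + 1) (+ 2 * i) ≡ + 2 * (+ 4 * a * i * i + (+ 2 * u + + 1) * i + c) + + 1
    odd-even = solve-∀
    odd-odd : ∀ a u c i → let P a u b x = + 2 * a * x * x + (+ 2 * u + + 1) * x + b in
      P a u (+ 2 * c + + 1) (+ 2 * i + + 1) ≡ + 2 * P (+ 2 * a) (+ 2 * a + u) (a + u + c + + 1) i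
    odd-odd = solve-∀

open OddSlopeRoots

module ProductCounts where

  open import Data.Nat as ℕ using (ℕ; suc; _^_)
  open import Data.Nat.Properties using (*-identityʳ)
  open import Data.Integer using (ℤ; +_; -_; _+_; _-_; _*_)
  open import Data.Integer.Tactic.RingSolver using (solve-∀)
  open import Relation.Binary.PropositionalEquality

  productCount : ℕ → ℕ → ℤ → ℕ
  productCount q N b = ∑[ y < N ] ∑[ z < N ] 𝟙[ q ∣ + y * + z - b ]

  ∑²-zero : ∀ m n (F : ℕ → ℕ → ℕ) → (∀ i j → F i j ≡ 0) → ∑[ i < m ] ∑[ j < n ] F i j ≡ 0
  ∑²-zero m n F F≡0 = trans (∑-cong m (λ i → trans (∑-cong n (F≡0 i)) (∑-zero n))) (∑-zero m)

  evenEvenCount evenOddCount : ℕ → ℤ → ℕ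
  evenEvenCount s b = ∑[ i < 2 ^ s ] ∑[ j < 2 ^ s ] 𝟙[ 2 ^ suc s ∣ (+ 2 * + i) * (+ 2 * + j) - b ]
  evenOddCount  s b = ∑[ i < 2 ^ s ] ∑[ j < 2 ^ s ] 𝟙[ 2 ^ suc s ∣ (+ 2 * + i) * (+ 2 * + j + + 1) - b ]

  -- For odd y the map z ↦ yz - b has an odd slope, so it hits 0 exactly once mod 2^(s+1).
  productCount-split : ∀ s b →
    productCount (2 ^ suc s) (2 ^ suc s) b ≡ evenEvenCount s b ℕ.+ evenOddCount s b ℕ.+ 2 ^ s
  productCount-split s b = begin
    productCount (2 ^ suc s) (2 ^ suc s) b
      ≡⟨ ∑-even-odd-ℤ (2 ^ s) (λ y → ∑[ z < 2 ^ suc s ] 𝟙[ 2 ^ suc s ∣ y * + z - b ]) ⟩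
    ∑[ i < 2 ^ s ] ∑[ z < 2 ^ suc s ] 𝟙[ 2 ^ suc s ∣ (+ 2 * + i) * + z - b ]
      ℕ.+ ∑[ i < 2 ^ s ] ∑[ z < 2 ^ suc s ] 𝟙[ 2 ^ suc s ∣ (+ 2 * + i + + 1) * + z - b ]
      ≡⟨ cong₂ ℕ._+_
           (trans (∑-cong (2 ^ s) (λ i → ∑-even-odd-ℤ (2 ^ s) (λ z → 𝟙[ 2 ^ suc s ∣ (+ 2 * + i) * z - b ])))
                  (∑-distrib-+ (2 ^ s) _ _))
           (trans (∑-cong (2 ^ s) (λ i →
                     trans (∑-cong (2 ^ suc s) (λ z → cong 𝟙[ 2 ^ suc s ∣_] (odd-row (+ i) (+ z) b)))
                           (oddSlope-root-count (suc s) (+ 0) (+ i) (- b))))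
                  (∑-const (2 ^ s) 1)) ⟩
    evenEvenCount s b ℕ.+ evenOddCount s b ℕ.+ 2 ^ s ℕ.* 1
      ≡⟨ cong (evenEvenCount s b ℕ.+ evenOddCount s b ℕ.+_) (*-identityʳ (2 ^ s)) ⟩
    evenEvenCount s b ℕ.+ evenOddCount s b ℕ.+ 2 ^ s ∎
    where
    open ≡-Reasoning
    odd-row : ∀ i z b → (+ 2 * i + + 1) * z - b ≡ + 2 * + 0 * z * z + (+ 2 * i + + 1) * z + - b
    odd-row = solve-∀

  evenEvenCount-odd : ∀ s c → evenEvenCount s (+ 2 * c + + 1) ≡ 0
  evenEvenCount-odd s c = ∑²-zero (2 ^ s) (2 ^ s) _ λ i j →
    𝟙∣-odd (2 ^ s) (+ 2 * + i * + j - c - + 1) (ring (+ i) (+ j) c)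
    where
    ring : ∀ i j c → (+ 2 * i) * (+ 2 * j) - (+ 2 * c + + 1) ≡ + 2 * (+ 2 * i * j - c - + 1) + + 1
    ring = solve-∀

  evenOddCount-odd : ∀ s c → evenOddCount s (+ 2 * c + + 1) ≡ 0
  evenOddCount-odd s c = ∑²-zero (2 ^ s) (2 ^ s) _ λ i j →
    𝟙∣-odd (2 ^ s) (+ i * (+ 2 * + j + + 1) - c - + 1) (ring (+ i) (+ j) c)
    where
    ring : ∀ i j c → (+ 2 * i) * (+ 2 * j + + 1) - (+ 2 * c + + 1) ≡ + 2 * (i * (+ 2 * j + + 1) - c - + 1) + + 1
    ring = solve-∀

  evenOddCount-even : ∀ s c → evenOddCount s (+ 2 * c) ≡ 2 ^ s
  evenOddCount-even s c = begin
    evenOddCount s (+ 2 * c)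
      ≡⟨ ∑-comm (2 ^ s) (2 ^ s) _ ⟩
    ∑[ j < 2 ^ s ] ∑[ i < 2 ^ s ] 𝟙[ 2 ^ suc s ∣ (+ 2 * + i) * (+ 2 * + j + + 1) - + 2 * c ]
      ≡⟨ ∑-cong (2 ^ s) (λ j → trans (∑-cong (2 ^ s) (λ i → 𝟙∣-even (2 ^ s) (ring (+ i) (+ j) c)))
                                     (oddSlope-root-count s (+ 0) (+ j) (- c))) ⟩
    ∑[ j < 2 ^ s ] 1
      ≡⟨ trans (∑-const (2 ^ s) 1) (*-identityʳ (2 ^ s)) ⟩
    2 ^ s ∎
    where
    open ≡-Reasoning
    ring : ∀ i j c → (+ 2 * i) * (+ 2 * j + + 1) - + 2 * c ≡ + 2 * (+ 2 * + 0 * i * i + (+ 2 * j + + 1) * i + - c)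
    ring = solve-∀

  evenEvenCount-2mod4 : ∀ r c → evenEvenCount (suc r) (+ 4 * c + + 2) ≡ 0
  evenEvenCount-2mod4 r c = ∑²-zero (2 ^ suc r) (2 ^ suc r) _ λ i j →
    trans (𝟙∣-even (2 ^ suc r) (ring (+ i) (+ j) c)) (𝟙∣-odd (2 ^ r) (+ i * + j - c - + 1) refl)
    where
    ring : ∀ i j c → (+ 2 * i) * (+ 2 * j) - (+ 4 * c + + 2) ≡ + 2 * (+ 2 * (i * j - c - + 1) + + 1)
    ring = solve-∀

  evenEvenCount-4∣ : ∀ r c → evenEvenCount (suc r) (+ 4 * c) ≡ productCount (2 ^ r) (2 ^ suc r) c
  evenEvenCount-4∣ r c = ∑-cong (2 ^ suc r) λ i → ∑-cong (2 ^ suc r) λ j →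
    trans (𝟙∣-even (2 ^ suc r) (ring (+ i) (+ j) c)) (𝟙∣-*2 (2 ^ r) (+ i * + j - c))
    where
    ring : ∀ i j c → (+ 2 * i) * (+ 2 * j) - + 4 * c ≡ + 2 * (+ 2 * (i * j - c))
    ring = solve-∀

  productCount-odd : ∀ s c → productCount (2 ^ suc s) (2 ^ suc s) (+ 2 * c + + 1) ≡ 2 ^ s
  productCount-odd s c = trans (productCount-split s (+ 2 * c + + 1))
    (cong₂ (λ e o → e ℕ.+ o ℕ.+ 2 ^ s) (evenEvenCount-odd s c) (evenOddCount-odd s c))

  productCount-2mod4 : ∀ r c →
    productCount (2 ^ suc (suc r)) (2 ^ suc (suc r)) (+ 4 * c + + 2) ≡ 2 ^ suc r ℕ.+ 2 ^ suc r
  productCount-2mod4 r c = trans (productCount-split (suc r) (+ 4 * c + + 2))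
    (cong₂ (λ e o → e ℕ.+ o ℕ.+ 2 ^ suc r) (evenEvenCount-2mod4 r c)
           (trans (cong (evenOddCount (suc r)) (ring c)) (evenOddCount-even (suc r) (+ 2 * c + + 1))))
    where
    ring : ∀ c → + 4 * c + + 2 ≡ + 2 * (+ 2 * c + + 1)
    ring = solve-∀

  productCount-4∣ : ∀ r c → productCount (2 ^ suc (suc r)) (2 ^ suc (suc r)) (+ 4 * c)
                          ≡ productCount (2 ^ r) (2 ^ suc r) c ℕ.+ 2 ^ suc r ℕ.+ 2 ^ suc r
  productCount-4∣ r c = trans (productCount-split (suc r) (+ 4 * c))
    (cong₂ (λ e o → e ℕ.+ o ℕ.+ 2 ^ suc r) (evenEvenCount-4∣ r c)
           (trans (cong (evenOddCount (suc r)) (ring c)) (evenOddCount-even (suc r) (+ 2 * c))))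
    where
    ring : ∀ c → + 4 * c ≡ + 2 * (+ 2 * c)
    ring = solve-∀

open ProductCounts

module Representations where

  open import Data.Nat as ℕ using (ℕ; zero; suc; _^_)
  import Data.Nat.Properties as ℕ
  import Data.Nat.Tactic.RingSolver as ℕ-Solver
  open import Data.Integer using (ℤ; +_; -_; _+_; _-_; _*_)
  open import Data.Integer.Properties using (pos-*)
  open import Data.Integer.Tactic.RingSolver using (solve-∀)
  open import Relation.Binary.PropositionalEquality

  RespectsMod : ℕ → (ℤ → ℤ → ℤ → ℤ) → Set
  RespectsMod q F = ∀ {x y z x′ y′ z′} → x ≈ x′ [mod q ] → y ≈ y′ [mod q ] → z ≈ z′ [mod q ] →
                    F x y z ≈ F x′ y′ z′ [mod q ]

  ∑³-𝟙-periodic : ∀ q F → RespectsMod q F →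
    ∑³ (2 ℕ.* q) (λ x y z → 𝟙[ q ∣ F (+ x) (+ y) (+ z) ]) ≡ 8 ℕ.* ∑³ q (λ x y z → 𝟙[ q ∣ F (+ x) (+ y) (+ z) ])
  ∑³-𝟙-periodic q F resp = ∑³-periodic q _
    (λ x y z → 𝟙∣-cong (resp (+[m+x]≈+x q x) (≈-refl (+ y)) (≈-refl (+ z))))
    (λ x y z → 𝟙∣-cong (resp (≈-refl (+ x)) (+[m+x]≈+x q y) (≈-refl (+ z))))
    (λ x y z → 𝟙∣-cong (resp (≈-refl (+ x)) (≈-refl (+ y)) (+[m+x]≈+x q z)))

  reps : ℕ → ℤ → ℕ
  reps t n = ∑³ (2 ^ t) λ x y z → 𝟙[ 2 ^ t ∣ + y * + z - (+ x * + x + n) ]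

  reps-respectsMod : ∀ q n → RespectsMod q (λ x y z → y * z - (x * x + n))
  reps-respectsMod q n x≈ y≈ z≈ = ≈-+ (≈-* y≈ z≈) (≈-neg (≈-+ (≈-* x≈ x≈) (≈-refl n)))

  2^*2^≡4^ : ∀ k → 2 ^ k ℕ.* 2 ^ k ≡ 4 ^ k
  2^*2^≡4^ zero    = refl
  2^*2^≡4^ (suc k) = trans (ring (2 ^ k)) (cong (4 ℕ.*_) (2^*2^≡4^ k))
    where
    ring : ∀ A → 2 ℕ.* A ℕ.* (2 ℕ.* A) ≡ 4 ℕ.* (A ℕ.* A)
    ring = ℕ-Solver.solve-∀

  ∑-+-const-const : ∀ m (f : ℕ → ℕ) c → ∑[ i < m ] (f i ℕ.+ c ℕ.+ c) ≡ ∑ m f ℕ.+ m ℕ.* c ℕ.+ m ℕ.* c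
  ∑-+-const-const m f c = begin
    ∑[ i < m ] (f i ℕ.+ c ℕ.+ c)          ≡⟨ ∑-distrib-+ m (λ i → f i ℕ.+ c) (λ _ → c) ⟩
    ∑[ i < m ] (f i ℕ.+ c) ℕ.+ ∑[ i < m ] c  ≡⟨ cong₂ ℕ._+_ (∑-distrib-+ m f (λ _ → c)) (∑-const m c) ⟩
    ∑ m f ℕ.+ ∑[ i < m ] c ℕ.+ m ℕ.* c      ≡⟨ cong (λ s → ∑ m f ℕ.+ s ℕ.+ m ℕ.* c) (∑-const m c) ⟩
    ∑ m f ℕ.+ m ℕ.* c ℕ.+ m ℕ.* c ∎
    where open ≡-Reasoning

  reps-4* : ∀ t n → reps (suc (suc t)) (+ 4 * n) ≡ 8 ℕ.* reps t n ℕ.+ 3 ℕ.* 4 ^ suc t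
  reps-4* t n = begin
    reps (suc (suc t)) (+ 4 * n)
      ≡⟨ ∑-even-odd-ℤ B (λ x → productCount M M (x * x + + 4 * n)) ⟩
    ∑[ i < B ] productCount M M ((+ 2 * + i) * (+ 2 * + i) + + 4 * n)
      ℕ.+ ∑[ i < B ] productCount M M ((+ 2 * + i + + 1) * (+ 2 * + i + + 1) + + 4 * n)
      ≡⟨ cong₂ ℕ._+_
           (∑-cong B (λ i → trans (cong (productCount M M) (even-square (+ i) n)) (productCount-4∣ t (+ i * + i + n))))
           (∑-cong B (λ i → trans (cong (productCount M M) (odd-square (+ i) n))
                                  (productCount-odd (suc t) (+ 2 * + i * + i + + 2 * + i + + 2 * n)))) ⟩
    ∑[ i < B ] (productCount (2 ^ t) B (+ i * + i + n) ℕ.+ B ℕ.+ B) ℕ.+ ∑[ i < B ] B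
      ≡⟨ cong₂ ℕ._+_ (∑-+-const-const B _ B) (∑-const B B) ⟩
    ∑³ B (λ x y z → 𝟙[ 2 ^ t ∣ + y * + z - (+ x * + x + n) ]) ℕ.+ B ℕ.* B ℕ.+ B ℕ.* B ℕ.+ B ℕ.* B
      ≡⟨ cong₂ (λ X G → X ℕ.+ G ℕ.+ G ℕ.+ G)
               (∑³-𝟙-periodic (2 ^ t) _ (reps-respectsMod (2 ^ t) n)) (2^*2^≡4^ (suc t)) ⟩
    8 ℕ.* reps t n ℕ.+ 4 ^ suc t ℕ.+ 4 ^ suc t ℕ.+ 4 ^ suc t
      ≡⟨ ring (8 ℕ.* reps t n) (4 ^ suc t) ⟩
    8 ℕ.* reps t n ℕ.+ 3 ℕ.* 4 ^ suc t ∎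
    where
    open ≡-Reasoning
    B = 2 ^ suc t
    M = 2 ^ suc (suc t)
    even-square : ∀ i n → (+ 2 * i) * (+ 2 * i) + + 4 * n ≡ + 4 * (i * i + n)
    even-square = solve-∀
    odd-square : ∀ i n → (+ 2 * i + + 1) * (+ 2 * i + + 1) + + 4 * n ≡ + 2 * (+ 2 * i * i + + 2 * i + + 2 * n) + + 1
    odd-square = solve-∀
    ring : ∀ X G → X ℕ.+ G ℕ.+ G ℕ.+ G ≡ X ℕ.+ 3 ℕ.* G
    ring = ℕ-Solver.solve-∀

  reps-1mod4 : ∀ r c → reps (suc (suc r)) (+ 4 * c + + 1) ≡ 3 ℕ.* 4 ^ suc r
  reps-1mod4 r c = begin
    reps (suc (suc r)) (+ 4 * c + + 1)
      ≡⟨ ∑-by-parity B (λ x → productCount M M (x * x + (+ 4 * c + + 1))) B (B ℕ.+ B)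
           (λ i → trans (cong (productCount M M) (even-square (+ i) c)) (productCount-odd (suc r) (+ 2 * + i * + i + + 2 * c)))
           (λ i → trans (cong (productCount M M) (odd-square (+ i) c)) (productCount-2mod4 r (+ i * + i + + i + c))) ⟩
    B ℕ.* B ℕ.+ B ℕ.* (B ℕ.+ B)   ≡⟨ ring B ⟩
    3 ℕ.* (B ℕ.* B)               ≡⟨ cong (3 ℕ.*_) (2^*2^≡4^ (suc r)) ⟩
    3 ℕ.* 4 ^ suc r ∎
    where
    open ≡-Reasoning
    B = 2 ^ suc r
    M = 2 ^ suc (suc r)
    even-square : ∀ i c → (+ 2 * i) * (+ 2 * i) + (+ 4 * c + + 1) ≡ + 2 * (+ 2 * i * i + + 2 * c) + + 1
    even-square = solve-∀
    odd-square : ∀ i c → (+ 2 * i + + 1) * (+ 2 * i + + 1) + (+ 4 * c + + 1) ≡ + 4 * (i * i + i + c) + + 2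
    odd-square = solve-∀
    ring : ∀ B → B ℕ.* B ℕ.+ B ℕ.* (B ℕ.+ B) ≡ 3 ℕ.* (B ℕ.* B)
    ring = ℕ-Solver.solve-∀

  reps-2mod4 : ∀ r c → reps (suc (suc r)) (+ 4 * c + + 2) ≡ 3 ℕ.* 4 ^ suc r
  reps-2mod4 r c = begin
    reps (suc (suc r)) (+ 4 * c + + 2)
      ≡⟨ ∑-by-parity B (λ x → productCount M M (x * x + (+ 4 * c + + 2))) (B ℕ.+ B) B
           (λ i → trans (cong (productCount M M) (even-square (+ i) c)) (productCount-2mod4 r (+ i * + i + c)))
           (λ i → trans (cong (productCount M M) (odd-square (+ i) c))
                        (productCount-odd (suc r) (+ 2 * + i * + i + + 2 * + i + + 2 * c + + 1))) ⟩
    B ℕ.* (B ℕ.+ B) ℕ.+ B ℕ.* B   ≡⟨ ring B ⟩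
    3 ℕ.* (B ℕ.* B)               ≡⟨ cong (3 ℕ.*_) (2^*2^≡4^ (suc r)) ⟩
    3 ℕ.* 4 ^ suc r ∎
    where
    open ≡-Reasoning
    B = 2 ^ suc r
    M = 2 ^ suc (suc r)
    even-square : ∀ i c → (+ 2 * i) * (+ 2 * i) + (+ 4 * c + + 2) ≡ + 4 * (i * i + c) + + 2
    even-square = solve-∀
    odd-square : ∀ i c → (+ 2 * i + + 1) * (+ 2 * i + + 1) + (+ 4 * c + + 2)
                       ≡ + 2 * (+ 2 * i * i + + 2 * i + + 2 * c + + 1) + + 1
    odd-square = solve-∀
    ring : ∀ B → B ℕ.* (B ℕ.+ B) ℕ.+ B ℕ.* B ≡ 3 ℕ.* (B ℕ.* B)
    ring = ℕ-Solver.solve-∀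

  pronicReps : ℕ → ℤ → ℕ
  pronicReps s e = ∑³ (2 ^ s) λ x y z → 𝟙[ 2 ^ s ∣ + y * + z - (+ x * + x + + x + e) ]

  pronicReps-respectsMod : ∀ q e → RespectsMod q (λ x y z → y * z - (x * x + x + e))
  pronicReps-respectsMod q e x≈ y≈ z≈ = ≈-+ (≈-* y≈ z≈) (≈-neg (≈-+ (≈-+ (≈-* x≈ x≈) x≈) (≈-refl e)))

  -- For odd x = 2i + 1 the equation becomes yz ≡ 4(i² + i + c + 1), a pronic problem two levels down.
  reps-3mod4 : ∀ r c → reps (suc (suc r)) (+ 4 * c + + 3) ≡ 3 ℕ.* 4 ^ suc r ℕ.+ 8 ℕ.* pronicReps r (c + + 1)
  reps-3mod4 r c = begin
    reps (suc (suc r)) (+ 4 * c + + 3)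
      ≡⟨ ∑-even-odd-ℤ B (λ x → productCount M M (x * x + (+ 4 * c + + 3))) ⟩
    ∑[ i < B ] productCount M M ((+ 2 * + i) * (+ 2 * + i) + (+ 4 * c + + 3))
      ℕ.+ ∑[ i < B ] productCount M M ((+ 2 * + i + + 1) * (+ 2 * + i + + 1) + (+ 4 * c + + 3))
      ≡⟨ cong₂ ℕ._+_
           (∑-cong B (λ i → trans (cong (productCount M M) (even-square (+ i) c))
                                  (productCount-odd (suc r) (+ 2 * + i * + i + + 2 * c + + 1))))
           (∑-cong B (λ i → trans (cong (productCount M M) (odd-square (+ i) c))
                                  (productCount-4∣ r (+ i * + i + + i + (c + + 1))))) ⟩
    ∑[ i < B ] B ℕ.+ ∑[ i < B ] (productCount (2 ^ r) B (+ i * + i + + i + (c + + 1)) ℕ.+ B ℕ.+ B)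
      ≡⟨ cong₂ ℕ._+_ (∑-const B B) (∑-+-const-const B _ B) ⟩
    B ℕ.* B ℕ.+ (∑³ B (λ x y z → 𝟙[ 2 ^ r ∣ + y * + z - (+ x * + x + + x + (c + + 1)) ]) ℕ.+ B ℕ.* B ℕ.+ B ℕ.* B)
      ≡⟨ cong₂ (λ G X → G ℕ.+ (X ℕ.+ G ℕ.+ G)) (2^*2^≡4^ (suc r))
               (∑³-𝟙-periodic (2 ^ r) _ (pronicReps-respectsMod (2 ^ r) (c + + 1))) ⟩
    4 ^ suc r ℕ.+ (8 ℕ.* pronicReps r (c + + 1) ℕ.+ 4 ^ suc r ℕ.+ 4 ^ suc r)
      ≡⟨ ring (4 ^ suc r) (8 ℕ.* pronicReps r (c + + 1)) ⟩
    3 ℕ.* 4 ^ suc r ℕ.+ 8 ℕ.* pronicReps r (c + + 1) ∎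
    where
    open ≡-Reasoning
    B = 2 ^ suc r
    M = 2 ^ suc (suc r)
    even-square : ∀ i c → (+ 2 * i) * (+ 2 * i) + (+ 4 * c + + 3) ≡ + 2 * (+ 2 * i * i + + 2 * c + + 1) + + 1
    even-square = solve-∀
    odd-square : ∀ i c → (+ 2 * i + + 1) * (+ 2 * i + + 1) + (+ 4 * c + + 3) ≡ + 4 * (i * i + i + (c + + 1))
    odd-square = solve-∀
    ring : ∀ G X → G ℕ.+ (X ℕ.+ G ℕ.+ G) ≡ 3 ℕ.* G ℕ.+ X
    ring = ℕ-Solver.solve-∀

  private
    pronic-at-even : ∀ i d → (+ 2 * i) * (+ 2 * i) + + 2 * i + (+ 2 * d + + 1) ≡ + 2 * (+ 2 * i * i + i + d) + + 1
    pronic-at-even = solve-∀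
    pronic-at-odd : ∀ i d → (+ 2 * i + + 1) * (+ 2 * i + + 1) + (+ 2 * i + + 1) + (+ 2 * d + + 1)
                          ≡ + 2 * (+ 2 * i * i + + 3 * i + d + + 1) + + 1
    pronic-at-odd = solve-∀

  pronicReps-odd : ∀ s d → pronicReps (suc s) (+ 2 * d + + 1) ≡ 2 ℕ.* 4 ^ s
  pronicReps-odd s d = begin
    pronicReps (suc s) (+ 2 * d + + 1)
      ≡⟨ ∑-by-parity (2 ^ s) (λ x → productCount M M (x * x + x + (+ 2 * d + + 1))) (2 ^ s) (2 ^ s)
           (λ i → trans (cong (productCount M M) (pronic-at-even (+ i) d)) (productCount-odd s (+ 2 * + i * + i + + i + d)))
           (λ i → trans (cong (productCount M M) (pronic-at-odd (+ i) d))
                        (productCount-odd s (+ 2 * + i * + i + + 3 * + i + d + + 1))) ⟩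
    2 ^ s ℕ.* 2 ^ s ℕ.+ 2 ^ s ℕ.* 2 ^ s  ≡⟨ cong (λ G → G ℕ.+ G) (2^*2^≡4^ s) ⟩
    4 ^ s ℕ.+ 4 ^ s                       ≡⟨ cong (4 ^ s ℕ.+_) (ℕ.+-identityʳ (4 ^ s)) ⟨
    2 ℕ.* 4 ^ s ∎
    where
    open ≡-Reasoning
    M = 2 ^ suc s

  pronicRoots : ℕ → ℤ → ℕ
  pronicRoots s e = ∑[ x < 2 ^ s ] 𝟙[ 2 ^ s ∣ + x * + x + + x + e ]

  pronicRoots-even : ∀ s e → pronicRoots (suc s) (+ 2 * e) ≡ 2
  pronicRoots-even s e = trans (∑-even-odd-ℤ (2 ^ s) (λ x → 𝟙[ 2 ^ suc s ∣ x * x + x + + 2 * e ]))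
    (cong₂ ℕ._+_
      (trans (∑-cong (2 ^ s) (λ i → 𝟙∣-even (2 ^ s) (even-root (+ i) e))) (oddSlope-root-count s (+ 1) (+ 0) e))
      (trans (∑-cong (2 ^ s) (λ i → 𝟙∣-even (2 ^ s) (odd-root (+ i) e))) (oddSlope-root-count s (+ 1) (+ 1) (e + + 1))))
    where
    even-root : ∀ i e → let P a u b x = + 2 * a * x * x + (+ 2 * u + + 1) * x + b in
      (+ 2 * i) * (+ 2 * i) + + 2 * i + + 2 * e ≡ + 2 * P (+ 1) (+ 0) e i
    even-root = solve-∀
    odd-root : ∀ i e → let P a u b x = + 2 * a * x * x + (+ 2 * u + + 1) * x + b in
      (+ 2 * i + + 1) * (+ 2 * i + + 1) + (+ 2 * i + + 1) + + 2 * e ≡ + 2 * P (+ 1) (+ 1) (e + + 1) i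
    odd-root = solve-∀

  pronicRoots-odd : ∀ s e → pronicRoots (suc s) (+ 2 * e + + 1) ≡ 0
  pronicRoots-odd s e = trans (∑-even-odd-ℤ (2 ^ s) (λ x → 𝟙[ 2 ^ suc s ∣ x * x + x + (+ 2 * e + + 1) ]))
    (cong₂ ℕ._+_
      (trans (∑-cong (2 ^ s) (λ i → 𝟙∣-odd (2 ^ s) (+ 2 * + i * + i + + i + e) (pronic-at-even (+ i) e))) (∑-zero (2 ^ s)))
      (trans (∑-cong (2 ^ s) (λ i → 𝟙∣-odd (2 ^ s) (+ 2 * + i * + i + + 3 * + i + e + + 1) (pronic-at-odd (+ i) e)))
             (∑-zero (2 ^ s))))

  pronicReps-by-roots : ∀ s e → pronicReps s e ≡ ∑[ y < 2 ^ s ] ∑[ z < 2 ^ s ] pronicRoots s (e - + y * + z)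
  pronicReps-by-roots s e = trans (∑³-rotate (2 ^ s) _) (∑-cong (2 ^ s) λ y → ∑-cong (2 ^ s) λ z → ∑-cong (2 ^ s) λ x →
    trans (cong 𝟙[ 2 ^ s ∣_] (ring (+ x) (+ y) (+ z) e)) (𝟙∣-neg (2 ^ s) (+ x * + x + + x + (e - + y * + z))))
    where
    ring : ∀ x y z e → y * z - (x * x + x + e) ≡ - (x * x + x + (e - y * z))
    ring = solve-∀

  ∑²-pronicRoots-even : ∀ s {F : ℕ → ℕ → ℤ} (c : ℕ → ℕ → ℤ) → (∀ a b → F a b ≡ + 2 * c a b) →
    ∑[ a < 2 ^ s ] ∑[ b < 2 ^ s ] pronicRoots (suc s) (F a b) ≡ 2 ^ s ℕ.* (2 ^ s ℕ.* 2)
  ∑²-pronicRoots-even s c F≡2c = trans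
    (∑-cong (2 ^ s) λ a → trans (∑-cong (2 ^ s) λ b → trans (cong (pronicRoots (suc s)) (F≡2c a b)) (pronicRoots-even s (c a b)))
                                (∑-const (2 ^ s) 2))
    (∑-const (2 ^ s) (2 ^ s ℕ.* 2))

  -- x² + x ≡ yz - 2d has two roots when yz is even, i.e. for three quarters of the pairs (y, z).
  pronicReps-even : ∀ s d → pronicReps (suc s) (+ 2 * d) ≡ 6 ℕ.* 4 ^ s
  pronicReps-even s d = begin
    pronicReps (suc s) (+ 2 * d)
      ≡⟨ trans (pronicReps-by-roots (suc s) (+ 2 * d)) (∑²-even-odd-ℤ (2 ^ s) (λ y z → pronicRoots (suc s) (+ 2 * d - y * z))) ⟩
    (∑[ a < A ] ∑[ b < A ] pronicRoots (suc s) (+ 2 * d - (+ 2 * + a) * (+ 2 * + b))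
      ℕ.+ ∑[ a < A ] ∑[ b < A ] pronicRoots (suc s) (+ 2 * d - (+ 2 * + a) * (+ 2 * + b + + 1)))
    ℕ.+ (∑[ a < A ] ∑[ b < A ] pronicRoots (suc s) (+ 2 * d - (+ 2 * + a + + 1) * (+ 2 * + b))
      ℕ.+ ∑[ a < A ] ∑[ b < A ] pronicRoots (suc s) (+ 2 * d - (+ 2 * + a + + 1) * (+ 2 * + b + + 1)))
      ≡⟨ cong₂ ℕ._+_
           (cong₂ ℕ._+_ (∑²-pronicRoots-even s (λ a b → d - + 2 * + a * + b) (λ a b → ee d (+ a) (+ b)))
                        (∑²-pronicRoots-even s (λ a b → d - + a * (+ 2 * + b + + 1)) (λ a b → eo d (+ a) (+ b))))
           (cong₂ ℕ._+_ (∑²-pronicRoots-even s (λ a b → d - (+ 2 * + a + + 1) * + b) (λ a b → oe d (+ a) (+ b)))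
                        (∑²-zero A A _ λ a b → trans (cong (pronicRoots (suc s)) (oo d (+ a) (+ b)))
                                                     (pronicRoots-odd s (d - + 2 * + a * + b - + a - + b - + 1)))) ⟩
    A ℕ.* (A ℕ.* 2) ℕ.+ A ℕ.* (A ℕ.* 2) ℕ.+ (A ℕ.* (A ℕ.* 2) ℕ.+ 0)
      ≡⟨ ring A ⟩
    6 ℕ.* (A ℕ.* A)
      ≡⟨ cong (6 ℕ.*_) (2^*2^≡4^ s) ⟩
    6 ℕ.* 4 ^ s ∎
    where
    open ≡-Reasoning
    A = 2 ^ s
    ee : ∀ d a b → + 2 * d - (+ 2 * a) * (+ 2 * b) ≡ + 2 * (d - + 2 * a * b)
    ee = solve-∀
    eo : ∀ d a b → + 2 * d - (+ 2 * a) * (+ 2 * b + + 1) ≡ + 2 * (d - a * (+ 2 * b + + 1))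
    eo = solve-∀
    oe : ∀ d a b → + 2 * d - (+ 2 * a + + 1) * (+ 2 * b) ≡ + 2 * (d - (+ 2 * a + + 1) * b)
    oe = solve-∀
    oo : ∀ d a b → + 2 * d - (+ 2 * a + + 1) * (+ 2 * b + + 1) ≡ + 2 * (d - + 2 * a * b - a - b - + 1) + + 1
    oo = solve-∀
    ring : ∀ A → A ℕ.* (A ℕ.* 2) ℕ.+ A ℕ.* (A ℕ.* 2) ℕ.+ (A ℕ.* (A ℕ.* 2) ℕ.+ 0) ≡ 6 ℕ.* (A ℕ.* A)
    ring = ℕ-Solver.solve-∀

  reps-3mod8 : ∀ r j → reps (suc (suc (suc r))) (+ 4 * (+ 2 * j) + + 3) ≡ 4 ^ suc (suc (suc r))
  reps-3mod8 r j = begin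
    reps (suc (suc (suc r))) (+ 4 * (+ 2 * j) + + 3)      ≡⟨ reps-3mod4 (suc r) (+ 2 * j) ⟩
    3 ℕ.* G ℕ.+ 8 ℕ.* pronicReps (suc r) (+ 2 * j + + 1)  ≡⟨ cong (λ p → 3 ℕ.* G ℕ.+ 8 ℕ.* p) (pronicReps-odd r j) ⟩
    3 ℕ.* G ℕ.+ 8 ℕ.* (2 ℕ.* 4 ^ r)                       ≡⟨ ring (4 ^ r) ⟩
    4 ^ suc (suc (suc r)) ∎
    where
    open ≡-Reasoning
    G = 4 ^ suc (suc r)
    ring : ∀ G → 3 ℕ.* (4 ℕ.* (4 ℕ.* G)) ℕ.+ 8 ℕ.* (2 ℕ.* G) ≡ 4 ℕ.* (4 ℕ.* (4 ℕ.* G))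
    ring = ℕ-Solver.solve-∀

  reps-7mod8 : ∀ r j → reps (suc (suc (suc r))) (+ 4 * (+ 2 * j + + 1) + + 3) ≡ 6 ℕ.* 4 ^ suc (suc r)
  reps-7mod8 r j = begin
    reps (suc (suc (suc r))) (+ 4 * (+ 2 * j + + 1) + + 3)        ≡⟨ reps-3mod4 (suc r) (+ 2 * j + + 1) ⟩
    3 ℕ.* G ℕ.+ 8 ℕ.* pronicReps (suc r) (+ 2 * j + + 1 + + 1)  ≡⟨ cong (λ e → 3 ℕ.* G ℕ.+ 8 ℕ.* pronicReps (suc r) e) (odd+1 j) ⟩
    3 ℕ.* G ℕ.+ 8 ℕ.* pronicReps (suc r) (+ 2 * (j + + 1))      ≡⟨ cong (λ p → 3 ℕ.* G ℕ.+ 8 ℕ.* p) (pronicReps-even r (j + + 1)) ⟩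
    3 ℕ.* G ℕ.+ 8 ℕ.* (6 ℕ.* 4 ^ r)                             ≡⟨ ring (4 ^ r) ⟩
    6 ℕ.* G ∎
    where
    open ≡-Reasoning
    G = 4 ^ suc (suc r)
    odd+1 : ∀ j → + 2 * j + + 1 + + 1 ≡ + 2 * (j + + 1)
    odd+1 = solve-∀
    ring : ∀ G → 3 ℕ.* (4 ℕ.* (4 ℕ.* G)) ℕ.+ 8 ℕ.* (6 ℕ.* G) ≡ 6 ℕ.* (4 ℕ.* (4 ℕ.* G))
    ring = ℕ-Solver.solve-∀

  -- ClosedForm A c n T: for t ≥ T the ratio reps t n / 4^t equals 3/2 - c/(2A).
  ClosedForm : ℕ → ℕ → ℤ → ℕ → Set
  ClosedForm A c n T = ∀ t → T ℕ.≤ t → 2 ℕ.* A ℕ.* reps t n ℕ.+ c ℕ.* 4 ^ t ≡ 3 ℕ.* A ℕ.* 4 ^ t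

  closedForm-4* : ∀ A c n T → ClosedForm A c n T → ClosedForm (2 ℕ.* A) c (+ 4 * n) (2 ℕ.+ T)
  closedForm-4* A c n T closed (suc (suc t)) (ℕ.s≤s (ℕ.s≤s T≤t)) = begin
    2 ℕ.* (2 ℕ.* A) ℕ.* reps (suc (suc t)) (+ 4 * n) ℕ.+ c ℕ.* 4 ^ suc (suc t)
      ≡⟨ cong (λ R → 2 ℕ.* (2 ℕ.* A) ℕ.* R ℕ.+ c ℕ.* 4 ^ suc (suc t)) (reps-4* t n) ⟩
    2 ℕ.* (2 ℕ.* A) ℕ.* (8 ℕ.* reps t n ℕ.+ 3 ℕ.* (4 ℕ.* 4 ^ t)) ℕ.+ c ℕ.* (4 ℕ.* (4 ℕ.* 4 ^ t))
      ≡⟨ ring₁ A c (reps t n) (4 ^ t) ⟩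
    16 ℕ.* (2 ℕ.* A ℕ.* reps t n ℕ.+ c ℕ.* 4 ^ t) ℕ.+ 48 ℕ.* A ℕ.* 4 ^ t
      ≡⟨ cong (λ X → 16 ℕ.* X ℕ.+ 48 ℕ.* A ℕ.* 4 ^ t) (closed t T≤t) ⟩
    16 ℕ.* (3 ℕ.* A ℕ.* 4 ^ t) ℕ.+ 48 ℕ.* A ℕ.* 4 ^ t
      ≡⟨ ring₂ A (4 ^ t) ⟩
    3 ℕ.* (2 ℕ.* A) ℕ.* 4 ^ suc (suc t) ∎
    where
    open ≡-Reasoning
    ring₁ : ∀ A c R G → 2 ℕ.* (2 ℕ.* A) ℕ.* (8 ℕ.* R ℕ.+ 3 ℕ.* (4 ℕ.* G)) ℕ.+ c ℕ.* (4 ℕ.* (4 ℕ.* G))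
                      ≡ 16 ℕ.* (2 ℕ.* A ℕ.* R ℕ.+ c ℕ.* G) ℕ.+ 48 ℕ.* A ℕ.* G
    ring₁ = ℕ-Solver.solve-∀
    ring₂ : ∀ A G → 16 ℕ.* (3 ℕ.* A ℕ.* G) ℕ.+ 48 ℕ.* A ℕ.* G ≡ 3 ℕ.* (2 ℕ.* A) ℕ.* (4 ℕ.* (4 ℕ.* G))
    ring₂ = ℕ-Solver.solve-∀

  closedForm-4^ : ∀ A c k T → ClosedForm A c (+ k) T → ∀ a → ClosedForm (2 ^ a ℕ.* A) c (+ (4 ^ a ℕ.* k)) (a ℕ.* 2 ℕ.+ T)
  closedForm-4^ A c k T closed zero = subst₂ (λ A′ k′ → ClosedForm A′ c (+ k′) T)
    (sym (ℕ.*-identityˡ A)) (sym (ℕ.*-identityˡ k)) closed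
  closedForm-4^ A c k T closed (suc a) = subst₂ (λ A′ n′ → ClosedForm A′ c n′ (suc a ℕ.* 2 ℕ.+ T))
    (sym (ℕ.*-assoc 2 (2 ^ a) A))
    (trans (sym (pos-* 4 (4 ^ a ℕ.* k))) (cong +_ (sym (ℕ.*-assoc 4 (4 ^ a) k))))
    (closedForm-4* (2 ^ a ℕ.* A) c (+ (4 ^ a ℕ.* k)) (a ℕ.* 2 ℕ.+ T) (closedForm-4^ A c k T closed a))

open Representations

module ListCounting where

  open import Data.Nat as ℕ using (ℕ; zero; suc; _^_)
  open import Data.Integer using (+_; _-_; ∣_∣)
  import Data.Nat.Divisibility as ℕ
  open import Data.List using (List; []; _∷_; _++_; length; filter; map; concatMap; applyUpTo)
  open import Data.List.Properties using (filter-++; length-++)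
  open import Data.Product using (_×_; _,_)
  open import Function using (_∘_)
  open import Relation.Nullary using (yes; no)
  open import Relation.Unary using (Decidable)
  open import Relation.Binary.PropositionalEquality

  module _ {A : Set} {P : A → Set} (P? : Decidable P) where

    count : List A → ℕ
    count xs = length (filter P? xs)

    count-++ : ∀ xs ys → count (xs ++ ys) ≡ count xs ℕ.+ count ys
    count-++ xs ys = trans (cong length (filter-++ P? xs ys)) (length-++ (filter P? xs))

    count-[_] : ∀ x → count (x ∷ []) ≡ 𝟙 (P? x)
    count-[ x ] with P? x
    ... | yes _ = refl
    ... | no  _ = refl

    count-concatMap : ∀ {B : Set} (g : B → List A) (f : ℕ → B) m →
      count (concatMap g (applyUpTo f m)) ≡ ∑[ i < m ] count (g (f i))
    count-concatMap g f zero    = refl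
    count-concatMap g f (suc m) =
      trans (count-++ (g (f 0)) _) (cong (count (g (f 0)) ℕ.+_) (count-concatMap g (f ∘ suc) m))

    count-map : ∀ {B : Set} (h : B → A) (f : ℕ → B) m →
      count (map h (applyUpTo f m)) ≡ ∑[ i < m ] 𝟙 (P? (h (f i)))
    count-map h f zero    = refl
    count-map h f (suc m) =
      trans (count-++ (h (f 0) ∷ []) _) (cong₂ ℕ._+_ (count-[ h (f 0) ]) (count-map h (f ∘ suc) m))

  count₂≡∑³ : ∀ f n t → count₂ f n t ≡ ∑³ (2 ^ t) λ x y z → 𝟙[ 2 ^ t ∣ eval f (+ x) (+ y) (+ z) - n ]
  count₂≡∑³ f n t = trans (count-concatMap P? _ (λ x → x) (2 ^ t))
    (∑-cong (2 ^ t) λ x → trans (count-concatMap P? _ (λ y → y) (2 ^ t))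
    (∑-cong (2 ^ t) λ y → count-map P? _ (λ z → z) (2 ^ t)))
    where
    -- Definitionally the predicate filtered by count₂, since its pattern lambda on triples η-expands.
    P? : Decidable {A = ℕ × ℕ × ℕ} _
    P? (x , y , z) = 2 ^ t ℕ.∣? ∣ eval f (+ x) (+ y) (+ z) - n ∣

open ListCounting

module Substitutions where

  open import Data.Fin using (Fin)
  open import Data.Fin.Patterns using (0F; 1F; 2F)
  open import Data.Integer using (ℤ; _+_; _-_; _*_; 0ℤ; 1ℤ)
  open import Data.Product using (_,_)
  open import Data.Integer.Tactic.RingSolver using (solve-∀)
  open import Relation.Binary.PropositionalEquality

  apply : Mat3 → ℤ → ℤ → ℤ → Fin 3 → ℤ
  apply M x y z k = M k 0F * x + M k 1F * y + M k 2F * z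

  _∙_ : Mat3 → Mat3 → ℤ → ℤ → ℤ → Fin 3 → ℤ
  (A ∙ B) x y z = apply A (apply B x y z 0F) (apply B x y z 1F) (apply B x y z 2F)

  coordinate : ℤ → ℤ → ℤ → Fin 3 → ℤ
  coordinate x y z 0F = x
  coordinate x y z 1F = y
  coordinate x y z 2F = z

  module Entries (M : Mat3) where
    a = M 0F 0F
    b = M 0F 1F
    c = M 0F 2F
    d = M 1F 0F
    e = M 1F 1F
    f = M 1F 2F
    g = M 2F 0F
    h = M 2F 1F
    i = M 2F 2F

  scaledAdjugate : ℤ → Mat3 → Mat3
  scaledAdjugate s M 0F 0F = s * (e * i - f * h) where open Entries M
  scaledAdjugate s M 0F 1F = s * (c * h - b * i) where open Entries M
  scaledAdjugate s M 0F 2F = s * (b * f - c * e) where open Entries M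
  scaledAdjugate s M 1F 0F = s * (f * g - d * i) where open Entries M
  scaledAdjugate s M 1F 1F = s * (a * i - c * g) where open Entries M
  scaledAdjugate s M 1F 2F = s * (c * d - a * f) where open Entries M
  scaledAdjugate s M 2F 0F = s * (d * h - e * g) where open Entries M
  scaledAdjugate s M 2F 1F = s * (b * g - a * h) where open Entries M
  scaledAdjugate s M 2F 2F = s * (a * e - b * d) where open Entries M

  private
    M∙adj₀ : ∀ s a b c d e f g h i x y z →
      let X = s * (e * i - f * h) * x + s * (c * h - b * i) * y + s * (b * f - c * e) * z
          Y = s * (f * g - d * i) * x + s * (a * i - c * g) * y + s * (c * d - a * f) * z
          Z = s * (d * h - e * g) * x + s * (b * g - a * h) * y + s * (a * e - b * d) * z
      in a * X + b * Y + c * Z ≡ s * (a * (e * i - f * h) - b * (d * i - f * g) + c * (d * h - e * g)) * x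
    M∙adj₀ = solve-∀
    M∙adj₁ : ∀ s a b c d e f g h i x y z →
      let X = s * (e * i - f * h) * x + s * (c * h - b * i) * y + s * (b * f - c * e) * z
          Y = s * (f * g - d * i) * x + s * (a * i - c * g) * y + s * (c * d - a * f) * z
          Z = s * (d * h - e * g) * x + s * (b * g - a * h) * y + s * (a * e - b * d) * z
      in d * X + e * Y + f * Z ≡ s * (a * (e * i - f * h) - b * (d * i - f * g) + c * (d * h - e * g)) * y
    M∙adj₁ = solve-∀
    M∙adj₂ : ∀ s a b c d e f g h i x y z →
      let X = s * (e * i - f * h) * x + s * (c * h - b * i) * y + s * (b * f - c * e) * z
          Y = s * (f * g - d * i) * x + s * (a * i - c * g) * y + s * (c * d - a * f) * z
          Z = s * (d * h - e * g) * x + s * (b * g - a * h) * y + s * (a * e - b * d) * z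
      in g * X + h * Y + i * Z ≡ s * (a * (e * i - f * h) - b * (d * i - f * g) + c * (d * h - e * g)) * z
    M∙adj₂ = solve-∀
    adj∙M₀ : ∀ s a b c d e f g h i x y z →
      let X = a * x + b * y + c * z
          Y = d * x + e * y + f * z
          Z = g * x + h * y + i * z
      in s * (e * i - f * h) * X + s * (c * h - b * i) * Y + s * (b * f - c * e) * Z
         ≡ s * (a * (e * i - f * h) - b * (d * i - f * g) + c * (d * h - e * g)) * x
    adj∙M₀ = solve-∀
    adj∙M₁ : ∀ s a b c d e f g h i x y z →
      let X = a * x + b * y + c * z
          Y = d * x + e * y + f * z
          Z = g * x + h * y + i * z
      in s * (f * g - d * i) * X + s * (a * i - c * g) * Y + s * (c * d - a * f) * Z
         ≡ s * (a * (e * i - f * h) - b * (d * i - f * g) + c * (d * h - e * g)) * y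
    adj∙M₁ = solve-∀
    adj∙M₂ : ∀ s a b c d e f g h i x y z →
      let X = a * x + b * y + c * z
          Y = d * x + e * y + f * z
          Z = g * x + h * y + i * z
      in s * (d * h - e * g) * X + s * (b * g - a * h) * Y + s * (a * e - b * d) * Z
         ≡ s * (a * (e * i - f * h) - b * (d * i - f * g) + c * (d * h - e * g)) * z
    adj∙M₂ = solve-∀

  ∙-scaledAdjugate : ∀ s M x y z k → (M ∙ scaledAdjugate s M) x y z k ≡ s * det3 M * coordinate x y z k
  ∙-scaledAdjugate s M x y z 0F = M∙adj₀ s a b c d e f g h i x y z where open Entries M
  ∙-scaledAdjugate s M x y z 1F = M∙adj₁ s a b c d e f g h i x y z where open Entries M
  ∙-scaledAdjugate s M x y z 2F = M∙adj₂ s a b c d e f g h i x y z where open Entries M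

  scaledAdjugate-∙ : ∀ s M x y z k → (scaledAdjugate s M ∙ M) x y z k ≡ s * det3 M * coordinate x y z k
  scaledAdjugate-∙ s M x y z 0F = adj∙M₀ s a b c d e f g h i x y z where open Entries M
  scaledAdjugate-∙ s M x y z 1F = adj∙M₁ s a b c d e f g h i x y z where open Entries M
  scaledAdjugate-∙ s M x y z 2F = adj∙M₂ s a b c d e f g h i x y z where open Entries M

  private
    polarisation : ∀ A B C D E F a b c d e f g h i x y z →
      let Q : ℤ → ℤ → ℤ → ℤ
          Q u v w = A * u * u + B * v * v + C * w * w + D * v * w + E * w * u + F * u * v
          P : ℤ → ℤ → ℤ → ℤ
          P x y z = Q (a * x + b * y + c * z) (d * x + e * y + f * z) (g * x + h * y + i * z)
      in P 1ℤ 0ℤ 0ℤ * x * x + P 0ℤ 1ℤ 0ℤ * y * y + P 0ℤ 0ℤ 1ℤ * z * z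
         + (P 0ℤ 1ℤ 1ℤ - P 0ℤ 1ℤ 0ℤ - P 0ℤ 0ℤ 1ℤ) * y * z
         + (P 1ℤ 0ℤ 1ℤ - P 0ℤ 0ℤ 1ℤ - P 1ℤ 0ℤ 0ℤ) * z * x
         + (P 1ℤ 1ℤ 0ℤ - P 1ℤ 0ℤ 0ℤ - P 0ℤ 1ℤ 0ℤ) * x * y
         ≡ P x y z
    polarisation = solve-∀

  eval-∘M : ∀ f M x y z → eval (f ∘M M) x y z ≡ evalSub f M x y z
  eval-∘M (form A B C D E F) M x y z = polarisation A B C D E F a b c d e f g h i x y z where open Entries M

  eval-cong : ∀ {q} f {x y z x′ y′ z′} → x ≈ x′ [mod q ] → y ≈ y′ [mod q ] → z ≈ z′ [mod q ] →
              eval f x y z ≈ eval f x′ y′ z′ [mod q ]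
  eval-cong (form a b c d e f) x≈ y≈ z≈ =
    ≈-+ (≈-+ (≈-+ (≈-+ (≈-+ (≈-* (≈-* (≈-refl a) x≈) x≈) (≈-* (≈-* (≈-refl b) y≈) y≈)) (≈-* (≈-* (≈-refl c) z≈) z≈))
                   (≈-* (≈-* (≈-refl d) y≈) z≈))
              (≈-* (≈-* (≈-refl e) z≈) x≈))
         (≈-* (≈-* (≈-refl f) x≈) y≈)

  eval-≅ : ∀ {q} f g x y z → f ≅ g [mod q ] → eval f x y z ≈ eval g x y z [mod q ]
  eval-≅ (form a b c d e f) (form a′ b′ c′ d′ e′ f′) x y z (a≡ , b≡ , c≡ , d≡ , e≡ , f≡) =
    ≈-+ (≈-+ (≈-+ (≈-+ (≈-+ (≈-* (≈-* (≡-mod⇒≈ a a′ a≡) (≈-refl x)) (≈-refl x))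
                            (≈-* (≈-* (≡-mod⇒≈ b b′ b≡) (≈-refl y)) (≈-refl y)))
                       (≈-* (≈-* (≡-mod⇒≈ c c′ c≡) (≈-refl z)) (≈-refl z)))
                  (≈-* (≈-* (≡-mod⇒≈ d d′ d≡) (≈-refl y)) (≈-refl z)))
             (≈-* (≈-* (≡-mod⇒≈ e e′ e≡) (≈-refl z)) (≈-refl x)))
        (≈-* (≈-* (≡-mod⇒≈ f f′ f≡) (≈-refl x)) (≈-refl y))

  apply-cong : ∀ {q} M {x y z x′ y′ z′} k → x ≈ x′ [mod q ] → y ≈ y′ [mod q ] → z ≈ z′ [mod q ] →
               apply M x y z k ≈ apply M x′ y′ z′ k [mod q ]
  apply-cong M k x≈ y≈ z≈ = ≈-+ (≈-+ (≈-* (≈-refl (M k 0F)) x≈) (≈-* (≈-refl (M k 1F)) y≈)) (≈-* (≈-refl (M k 2F)) z≈)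

open Substitutions

module Residues where

  open import Data.Nat as ℕ using (ℕ; zero; suc; _^_; _<_; NonZero)
  import Data.Nat.Properties as ℕ
  open import Data.Fin using (Fin)
  open import Data.Fin.Patterns using (0F; 1F; 2F)
  open import Data.Integer using (ℤ; +_; -_; _+_; _-_; _*_; 0ℤ; ∣_∣)
  open import Data.Integer.Properties
    using (+-injective; i-j≡0⇒i≡j; ∣i∣≡0⇒i≡0; m-n≡m⊖n; ∣m⊝n∣≤m⊔n; pos-*; *-comm; *-identityʳ)
  open import Data.Integer.DivMod using (_%ℕ_; _/ℕ_; n%ℕd<d; a≡a%ℕn+[a/ℕn]*n)
  open import Data.Integer.Divisibility.Signed using (divides; ∣⇒∣ᵤ)
  import Data.Nat.Divisibility as ℕ
  open import Data.Nat.DivMod using (m<n⇒m%n≡m)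
  open import Data.Empty using (⊥-elim)
  open import Data.Product using (_,_; ∃)
  open import Relation.Nullary using (¬_)
  open import Data.Integer.Tactic.RingSolver using (solve-∀)
  open import Relation.Binary.PropositionalEquality

  %ℕ-≈ : ∀ q .{{_ : NonZero q}} a → (+ (a %ℕ q)) ≈ a [mod q ]
  %ℕ-≈ q a = ≈-mod (divides (- (a /ℕ q)) (trans (cong (λ w → + (a %ℕ q) - w) (a≡a%ℕn+[a/ℕn]*n a q)) (ring (+ (a %ℕ q)) (a /ℕ q) (+ q))))
    where
    ring : ∀ r k q → r - (r + k * q) ≡ - k * q
    ring = solve-∀

  <-≈⇒≡ : ∀ {q r s} → r < q → s < q → (+ r) ≈ (+ s) [mod q ] → r ≡ s
  <-≈⇒≡ {q} {r} {s} r<q s<q (≈-mod q∣r-s) =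
    +-injective (i-j≡0⇒i≡j (+ r) (+ s) (∣i∣≡0⇒i≡0 (∣∧<⇒≡0 (∣⇒∣ᵤ q∣r-s) ∣r-s∣<q)))
    where
    ∣r-s∣<q : ∣ + r - + s ∣ < q
    ∣r-s∣<q = ℕ.≤-<-trans (subst (ℕ._≤ r ℕ.⊔ s) (cong ∣_∣ (sym (m-n≡m⊖n r s))) (∣m⊝n∣≤m⊔n r s)) (ℕ.⊔-lub r<q s<q)
    ∣∧<⇒≡0 : ∀ {d} → q ℕ.∣ d → d < q → d ≡ 0
    ∣∧<⇒≡0 {zero}  _   _   = refl
    ∣∧<⇒≡0 {suc d} q∣d d<q = ⊥-elim (ℕ.>⇒∤ d<q q∣d)

  %ℕ-cong : ∀ q .{{_ : NonZero q}} {a b} → a ≈ b [mod q ] → a %ℕ q ≡ b %ℕ q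
  %ℕ-cong q {a} {b} a≈b = <-≈⇒≡ (n%ℕd<d a q) (n%ℕd<d b q) (≈-trans (%ℕ-≈ q a) (≈-trans a≈b (≈-sym (%ℕ-≈ q b))))

  act : ∀ q .{{_ : NonZero q}} → Mat3 → Triple → Triple
  act q M (x , y , z) = reduce 0F , reduce 1F , reduce 2F
    where reduce = λ k → apply M (+ x) (+ y) (+ z) k %ℕ q

  act-inRange : ∀ q .{{_ : NonZero q}} M v → InRange q (act q M v)
  act-inRange q M (x , y , z) = n%ℕd<d (v 0F) q , n%ℕd<d (v 1F) q , n%ℕd<d (v 2F) q
    where v = apply M (+ x) (+ y) (+ z)

  act-inverse : ∀ q .{{_ : NonZero q}} A B → (∀ x y z k → (A ∙ B) x y z k ≈ coordinate x y z k [mod q ]) →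
                ∀ v → InRange q v → act q A (act q B v) ≡ v
  act-inverse q A B A∙B≈id (x , y , z) (x<q , y<q , z<q) =
    cong₂ _,_ (component 0F x refl x<q) (cong₂ _,_ (component 1F y refl y<q) (component 2F z refl z<q))
    where
    v : Fin 3 → ℤ
    v = apply B (+ x) (+ y) (+ z)
    component : ∀ k w → coordinate (+ x) (+ y) (+ z) k ≡ + w → w < q →
                apply A (+ (v 0F %ℕ q)) (+ (v 1F %ℕ q)) (+ (v 2F %ℕ q)) k %ℕ q ≡ w
    component k w x≡w w<q = trans
      (%ℕ-cong q (≈-trans (apply-cong A k (%ℕ-≈ q (v 0F)) (%ℕ-≈ q (v 1F)) (%ℕ-≈ q (v 2F)))
                          (≈-trans (A∙B≈id (+ x) (+ y) (+ z) k) (≈-reflexive x≡w))))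
      (m<n⇒m%n≡m w<q)

  odd-form : ∀ D → ¬ (2 ℕ.∣ ∣ D ∣) → ∃ λ d → D ≡ + 2 * d + + 1
  odd-form D 2∤D with parity D
  ... | even c = ⊥-elim (2∤D (∣⇒∣ᵤ (divides c (*-comm (+ 2) c))))
  ... | odd c  = c , refl

  private
    ring₁ : ∀ k P → (+ 2 * k) * P ≡ k * (+ 2 * P)
    ring₁ = solve-∀
    ring₂ : ∀ e P D → (e + P) * D - + 1 ≡ (e * D - + 1) + P * D
    ring₂ = solve-∀
    ring₃ : ∀ k P d → (+ 2 * k + + 1) * P + P * (+ 2 * d + + 1) ≡ (k + d + + 1) * (+ 2 * P)
    ring₃ = solve-∀

  -- Hensel lifting: an inverse e mod 2^t still works mod 2^(t+1) unless e·D - 1 is an odd multiple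
  -- of 2^t, in which case e + 2^t does.
  odd-invertible : ∀ t d → ∃ λ e → (e * (+ 2 * d + + 1)) ≈ (+ 1) [mod 2 ^ t ]
  odd-invertible zero    d = 0ℤ , ≈-mod (divides (0ℤ * (+ 2 * d + + 1) - + 1) (sym (*-identityʳ _)))
  odd-invertible (suc t) d with odd-invertible t d
  ... | e , ≈-mod (divides k eD-1≡k2ᵗ) with parity k
  ...   | even k′ = e , ≈-mod (divides k′ (trans eD-1≡k2ᵗ (trans (ring₁ k′ (+ (2 ^ t))) (cong (k′ *_) (sym (pos-* 2 (2 ^ t)))))))
  ...   | odd k′  = e + + (2 ^ t) , ≈-mod (divides (k′ + d + + 1) (begin
    (e + + (2 ^ t)) * (+ 2 * d + + 1) - + 1           ≡⟨ ring₂ e (+ (2 ^ t)) (+ 2 * d + + 1) ⟩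
    (e * (+ 2 * d + + 1) - + 1) + + (2 ^ t) * (+ 2 * d + + 1) ≡⟨ cong (_+ + (2 ^ t) * (+ 2 * d + + 1)) eD-1≡k2ᵗ ⟩
    (+ 2 * k′ + + 1) * + (2 ^ t) + + (2 ^ t) * (+ 2 * d + + 1) ≡⟨ ring₃ k′ (+ (2 ^ t)) d ⟩
    (k′ + d + + 1) * (+ 2 * + (2 ^ t))                ≡⟨ cong ((k′ + d + + 1) *_) (sym (pos-* 2 (2 ^ t))) ⟩
    (k′ + d + + 1) * + (2 ^ suc t) ∎))
    where open ≡-Reasoning

open Residues

module Invariance where

  open import Data.Nat as ℕ using (ℕ; _^_; NonZero)
  import Data.Nat.Properties as ℕ
  import Data.Nat.Divisibility as ℕ
  open import Data.Integer using (+_; -_; _-_; _*_; ∣_∣)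
  open import Data.Integer.Properties using (*-identityˡ)
  open import Data.Integer.DivMod using (_%ℕ_)
  open import Data.Fin.Patterns using (0F; 1F; 2F)
  open import Data.Product using (_,_)
  open import Relation.Nullary using (¬_)
  open import Relation.Binary.PropositionalEquality

  count₂-invariant : ∀ f g n t M → ¬ (2 ℕ.∣ ∣ det3 M ∣) → (f ∘M M) ≅ g [mod 2 ^ t ] → count₂ f n t ≡ count₂ g n t
  count₂-invariant f g n t M 2∤det f∘M≅g with odd-form (det3 M) 2∤det
  ... | d , det≡ with odd-invertible t d
  ...   | s , s·det≈1 = begin
    count₂ f n t
      ≡⟨ count₂≡∑³ f n t ⟩
    ∑³ q (λ x y z → H (x , y , z))
      ≡⟨ ∑³-bijection q H φ ψ (act-inRange q M) (act-inRange q N)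
           (act-inverse q N M (inverse N M (scaledAdjugate-∙ s M))) (act-inverse q M N (inverse M N (∙-scaledAdjugate s M))) ⟨
    ∑³ q (λ x y z → H (φ (x , y , z)))
      ≡⟨ ∑³-cong q (λ x y z _ _ _ → 𝟙∣-cong (≈-+ (transformed x y z) (≈-refl (- n)))) ⟩
    ∑³ q (λ x y z → 𝟙[ q ∣ eval g (+ x) (+ y) (+ z) - n ])
      ≡⟨ count₂≡∑³ g n t ⟨
    count₂ g n t ∎
    where
    open ≡-Reasoning
    q = 2 ^ t
    instance
      q≢0 : NonZero q
      q≢0 = ℕ.m^n≢0 2 t
    N = scaledAdjugate s M
    φ = act q M
    ψ = act q N
    H : Triple → ℕ
    H (x , y , z) = 𝟙[ q ∣ eval f (+ x) (+ y) (+ z) - n ]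
    s·det≈1′ : (s * det3 M) ≈ (+ 1) [mod q ]
    s·det≈1′ = subst (λ D → (s * D) ≈ (+ 1) [mod q ]) (sym det≡) s·det≈1
    inverse : ∀ A B → (∀ x y z k → (A ∙ B) x y z k ≡ s * det3 M * coordinate x y z k) →
              ∀ x y z k → (A ∙ B) x y z k ≈ coordinate x y z k [mod q ]
    inverse A B A∙B≡ x y z k = ≈-trans (≈-reflexive (A∙B≡ x y z k))
      (≈-trans (≈-* s·det≈1′ (≈-refl (coordinate x y z k))) (≈-reflexive (*-identityˡ (coordinate x y z k))))
    transformed : ∀ x y z → eval f (+ (apply M (+ x) (+ y) (+ z) 0F %ℕ q)) (+ (apply M (+ x) (+ y) (+ z) 1F %ℕ q))
                                   (+ (apply M (+ x) (+ y) (+ z) 2F %ℕ q)) ≈ eval g (+ x) (+ y) (+ z) [mod q ]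
    transformed x y z = ≈-trans (eval-cong f (%ℕ-≈ q (v 0F)) (%ℕ-≈ q (v 1F)) (%ℕ-≈ q (v 2F)))
      (≈-trans (≈-reflexive (sym (eval-∘M f M (+ x) (+ y) (+ z)))) (eval-≅ (f ∘M M) g (+ x) (+ y) (+ z) f∘M≅g))
      where v = apply M (+ x) (+ y) (+ z)

open Invariance

module Densities where

  open import Data.Nat as ℕ using (ℕ; suc; _^_; NonZero; s≤s)
  import Data.Nat.Properties as ℕ
  import Data.Nat.DivMod as ℕ
  import Data.Nat.Tactic.RingSolver as ℕ-Solver
  open import Data.Integer as ℤ using (ℤ; +_; -_; _+_; _-_; _*_; 0ℤ; 1ℤ)
  import Data.Integer.Properties as ℤ
  open import Data.Integer.Tactic.RingSolver using (solve-∀)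
  open import Data.Rational as ℚ using (ℚ; _/_)
  import Data.Rational.Properties as ℚ
  import Data.Rational.Unnormalised as ℚᵘ
  import Data.Rational.Unnormalised.Properties as ℚᵘ
  open import Data.Product using (_,_)
  open import Data.Sum using (_⊎_; inj₁; inj₂)
  open import Relation.Binary.PropositionalEquality

  cross-mul⇒/≡/ : ∀ i j n m .{{_ : NonZero n}} .{{_ : NonZero m}} → i * + m ≡ j * + n → i / n ≡ j / m
  cross-mul⇒/≡/ i j (suc n) (suc m) eq = ℚ.fromℚᵘ-cong {ℚᵘ.mkℚᵘ i n} {ℚᵘ.mkℚᵘ j m} (ℚᵘ.*≡* eq)

  /-sub-/ : ∀ i j n m .{{_ : NonZero n}} .{{_ : NonZero m}} →
            i / n ℚ.- j / m ≡ _/_ (i * + m - j * + n) (n ℕ.* m) {{ℕ.m*n≢0 n m}}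
  /-sub-/ i j (suc n) (suc m) = ℚ.toℚᵘ-injective (begin
    ℚ.toℚᵘ (i / suc n ℚ.- j / suc m)
      ≈⟨ ℚ.toℚᵘ-homo-+ (i / suc n) (ℚ.- (j / suc m)) ⟩
    ℚ.toℚᵘ (i / suc n) ℚᵘ.+ ℚ.toℚᵘ (ℚ.- (j / suc m))
      ≈⟨ ℚᵘ.+-cong (ℚ.toℚᵘ-fromℚᵘ (ℚᵘ.mkℚᵘ i n))
                   (ℚᵘ.≃-trans (ℚ.toℚᵘ-homo‿- (j / suc m)) (ℚᵘ.-‿cong (ℚ.toℚᵘ-fromℚᵘ (ℚᵘ.mkℚᵘ j m)))) ⟩
    ℚᵘ.mkℚᵘ i n ℚᵘ.+ ℚᵘ.- ℚᵘ.mkℚᵘ j m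
      ≈⟨ ℚᵘ.*≡* (ring i j (+ suc m) (+ suc n) _) ⟩
    ℚᵘ.mkℚᵘ (i * + suc m - j * + suc n) (ℕ.pred (suc n ℕ.* suc m))
      ≈⟨ ℚᵘ.≃-sym (ℚ.toℚᵘ-fromℚᵘ _) ⟩
    ℚ.toℚᵘ (_/_ (i * + suc m - j * + suc n) (suc n ℕ.* suc m)) ∎)
    where
    open ℚᵘ.≃-Reasoning
    ring : ∀ i j a b c → (i * a + - j * b) * c ≡ (i * a - j * b) * c
    ring = solve-∀

  density-3/2 : ∀ N G .{{_ : NonZero G}} → 2 ℕ.* N ≡ 3 ℕ.* G → + N / G ≡ + 3 / 2
  density-3/2 N G 2N≡3G = cross-mul⇒/≡/ (+ N) (+ 3) G 2
    (trans (sym (ℤ.pos-* N 2)) (trans (cong +_ (trans (ℕ.*-comm N 2) 2N≡3G)) (ℤ.pos-* 3 G)))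

  density-3/2-minus : ∀ A c N G D .{{_ : NonZero G}} .{{_ : NonZero D}} → D ≡ 2 ℕ.* A →
                      2 ℕ.* A ℕ.* N ℕ.+ c ℕ.* G ≡ 3 ℕ.* A ℕ.* G → + N / G ≡ + 3 / 2 ℚ.- + c / D
  density-3/2-minus A c N G D {{G≢0}} {{D≢0}} refl eq =
    trans (cross-mul⇒/≡/ (+ N) (+ 3 * + D - + c * + 2) G (2 ℕ.* D) {{G≢0}} {{ℕ.m*n≢0 2 D}} cross)
          (sym (/-sub-/ (+ 3) (+ c) 2 D))
    where
    open ≡-Reasoning
    eqℤ : + 2 * + A * + N + + c * + G ≡ + 3 * + A * + G
    eqℤ = begin
      + 2 * + A * + N + + c * + G  ≡⟨ cong₂ _+_ (cong (_* + N) (ℤ.pos-* 2 A)) (ℤ.pos-* c G) ⟨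
      + (2 ℕ.* A) * + N + + (c ℕ.* G)    ≡⟨ cong₂ _+_ (ℤ.pos-* (2 ℕ.* A) N) refl ⟨
      + (2 ℕ.* A ℕ.* N) + + (c ℕ.* G)      ≡⟨ ℤ.pos-+ (2 ℕ.* A ℕ.* N) (c ℕ.* G) ⟨
      + (2 ℕ.* A ℕ.* N ℕ.+ c ℕ.* G)          ≡⟨ cong +_ eq ⟩
      + (3 ℕ.* A ℕ.* G)                       ≡⟨ ℤ.pos-* (3 ℕ.* A) G ⟩
      + (3 ℕ.* A) * + G                     ≡⟨ cong (_* + G) (ℤ.pos-* 3 A) ⟩
      + 3 * + A * + G ∎
    cross : + N * + (2 ℕ.* (2 ℕ.* A)) ≡ (+ 3 * + (2 ℕ.* A) - + c * + 2) * + G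
    cross = begin
      + N * + (2 ℕ.* (2 ℕ.* A))
        ≡⟨ cong (_*_ (+ N)) (trans (ℤ.pos-* 2 (2 ℕ.* A)) (cong (_*_ (+ 2)) (ℤ.pos-* 2 A))) ⟩
      + N * (+ 2 * (+ 2 * + A))
        ≡⟨ ring₁ (+ A) (+ c) (+ N) (+ G) ⟩
      + 2 * (+ 2 * + A * + N + + c * + G) - + 2 * (+ c * + G)
        ≡⟨ cong (λ X → + 2 * X - + 2 * (+ c * + G)) eqℤ ⟩
      + 2 * (+ 3 * + A * + G) - + 2 * (+ c * + G)
        ≡⟨ ring₂ (+ A) (+ c) (+ G) ⟩
      (+ 3 * (+ 2 * + A) - + c * + 2) * + G
        ≡⟨ cong (λ X → (+ 3 * X - + c * + 2) * + G) (ℤ.pos-* 2 A) ⟨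
      (+ 3 * + (2 ℕ.* A) - + c * + 2) * + G ∎
      where
      ring₁ : ∀ A c N G → N * (+ 2 * (+ 2 * A)) ≡ + 2 * (+ 2 * A * N + c * G) - + 2 * (c * G)
      ring₁ = solve-∀
      ring₂ : ∀ A c G → + 2 * (+ 3 * A * G) - + 2 * (c * G) ≡ (+ 3 * (+ 2 * A) - c * + 2) * G
      ring₂ = solve-∀

  count₂≡reps : ∀ f → Equiv₂ f yz-x² → ∀ n t → count₂ f n t ≡ reps t n
  count₂≡reps f f≈yz-x² n t with f≈yz-x² t
  ... | M , 2∤det , f∘M≅yz-x² =
    trans (count₂-invariant f yz-x² n t M 2∤det f∘M≅yz-x²)
          (trans (count₂≡∑³ yz-x² n t) (∑³-cong (2 ^ t) λ x y z _ _ _ → cong 𝟙[ 2 ^ t ∣_] (ring (+ x) (+ y) (+ z) n)))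
    where
    ring : ∀ x y z n → - 1ℤ * x * x + 0ℤ * y * y + 0ℤ * z * z + 1ℤ * y * z
                       + 0ℤ * z * x + 0ℤ * x * y - n ≡ y * z - (x * x + n)
    ring = solve-∀

  closedForm⇒density : ∀ f → Equiv₂ f yz-x² → ∀ A c n T D .{{_ : NonZero D}} → D ≡ 2 ℕ.* A →
                       ClosedForm A c n T → Density₂ f n (+ 3 / 2 ℚ.- + c / D)
  closedForm⇒density f f≈yz-x² A c n T D D≡2A closed = T , λ t T≤t →
    trans (cong (λ N → _/_ (+ N) (4 ^ t) {{ℕ.m^n≢0 4 t}}) (count₂≡reps f f≈yz-x² n t))
          (density-3/2-minus A c (reps t n) (4 ^ t) D {{ℕ.m^n≢0 4 t}} D≡2A (closed t T≤t))

  closedForm⇒density-3/2 : ∀ f → Equiv₂ f yz-x² → ∀ A n T .{{_ : NonZero A}} →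
                           ClosedForm A 0 n T → Density₂ f n (+ 3 / 2)
  closedForm⇒density-3/2 f f≈yz-x² A n T closed = T , λ t T≤t →
    trans (cong (λ N → _/_ (+ N) (4 ^ t) {{ℕ.m^n≢0 4 t}}) (count₂≡reps f f≈yz-x² n t))
          (density-3/2 (reps t n) (4 ^ t) {{ℕ.m^n≢0 4 t}}
            (ℕ.*-cancelˡ-≡ _ _ A (trans (ring A (reps t n) (4 ^ t)) (trans (closed t T≤t) (ring′ A (4 ^ t))))))
    where
    ring : ∀ A N G → A ℕ.* (2 ℕ.* N) ≡ 2 ℕ.* A ℕ.* N ℕ.+ 0 ℕ.* G
    ring = ℕ-Solver.solve-∀
    ring′ : ∀ A G → 3 ℕ.* A ℕ.* G ≡ A ℕ.* (3 ℕ.* G)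
    ring′ = ℕ-Solver.solve-∀

  +-by-residue : ∀ k m r .{{_ : NonZero m}} → k ℕ.% m ≡ r → + k ≡ + r + + (k ℕ./ m) * + m
  +-by-residue k m r k%m≡r = trans (cong +_ (trans (ℕ.m≡m%n+[m/n]*n k m) (cong (ℕ._+ k ℕ./ m ℕ.* m) k%m≡r)))
                                   (trans (ℤ.pos-+ r _) (cong (_+_ (+ r)) (ℤ.pos-* (k ℕ./ m) m)))

  closedForm-7mod8 : ∀ k → k ℕ.% 8 ≡ 7 → ClosedForm 1 0 (+ k) 3
  closedForm-7mod8 k _ 1 (s≤s ())
  closedForm-7mod8 k _ 2 (s≤s (s≤s ()))
  closedForm-7mod8 k k%8≡7 (suc (suc (suc r))) _ = begin
    2 ℕ.* 1 ℕ.* reps (suc (suc (suc r))) (+ k) ℕ.+ 0 ℕ.* 4 ^ suc (suc (suc r))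
      ≡⟨ cong (λ R → 2 ℕ.* 1 ℕ.* R ℕ.+ 0 ℕ.* 4 ^ suc (suc (suc r)))
              (trans (cong (reps (suc (suc (suc r)))) (trans (+-by-residue k 8 7 k%8≡7) (shape (+ (k ℕ./ 8)))))
                     (reps-7mod8 r (+ (k ℕ./ 8)))) ⟩
    2 ℕ.* 1 ℕ.* (6 ℕ.* 4 ^ suc (suc r)) ℕ.+ 0 ℕ.* 4 ^ suc (suc (suc r))
      ≡⟨ ring (4 ^ suc (suc r)) ⟩
    3 ℕ.* 1 ℕ.* 4 ^ suc (suc (suc r)) ∎
    where
    open ≡-Reasoning
    shape : ∀ j → + 7 + j * + 8 ≡ + 4 * (+ 2 * j + + 1) + + 3
    shape = solve-∀
    ring : ∀ G → 2 ℕ.* 1 ℕ.* (6 ℕ.* G) ℕ.+ 0 ℕ.* (4 ℕ.* G) ≡ 3 ℕ.* 1 ℕ.* (4 ℕ.* G)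
    ring = ℕ-Solver.solve-∀

  closedForm-3mod8 : ∀ k → k ℕ.% 8 ≡ 3 → ClosedForm 1 1 (+ k) 3
  closedForm-3mod8 k _ 1 (s≤s ())
  closedForm-3mod8 k _ 2 (s≤s (s≤s ()))
  closedForm-3mod8 k k%8≡3 (suc (suc (suc r))) _ = begin
    2 ℕ.* 1 ℕ.* reps (suc (suc (suc r))) (+ k) ℕ.+ 1 ℕ.* 4 ^ suc (suc (suc r))
      ≡⟨ cong (λ R → 2 ℕ.* 1 ℕ.* R ℕ.+ 1 ℕ.* 4 ^ suc (suc (suc r)))
              (trans (cong (reps (suc (suc (suc r)))) (trans (+-by-residue k 8 3 k%8≡3) (shape (+ (k ℕ./ 8)))))
                     (reps-3mod8 r (+ (k ℕ./ 8)))) ⟩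
    2 ℕ.* 1 ℕ.* 4 ^ suc (suc (suc r)) ℕ.+ 1 ℕ.* 4 ^ suc (suc (suc r))
      ≡⟨ ring (4 ^ suc (suc (suc r))) ⟩
    3 ℕ.* 1 ℕ.* 4 ^ suc (suc (suc r)) ∎
    where
    open ≡-Reasoning
    shape : ∀ j → + 3 + j * + 8 ≡ + 4 * (+ 2 * j) + + 3
    shape = solve-∀
    ring : ∀ G → 2 ℕ.* 1 ℕ.* G ℕ.+ 1 ℕ.* G ≡ 3 ℕ.* 1 ℕ.* G
    ring = ℕ-Solver.solve-∀

  closedForm-1or2mod4 : ∀ k → (k ℕ.% 4 ≡ 1 ⊎ k ℕ.% 4 ≡ 2) → ClosedForm 2 3 (+ k) 2
  closedForm-1or2mod4 k _ 1 (s≤s ())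
  closedForm-1or2mod4 k k%4 (suc (suc r)) _ = begin
    2 ℕ.* 2 ℕ.* reps (suc (suc r)) (+ k) ℕ.+ 3 ℕ.* 4 ^ suc (suc r)
      ≡⟨ cong (λ R → 2 ℕ.* 2 ℕ.* R ℕ.+ 3 ℕ.* 4 ^ suc (suc r)) (reps-k k%4) ⟩
    2 ℕ.* 2 ℕ.* (3 ℕ.* 4 ^ suc r) ℕ.+ 3 ℕ.* 4 ^ suc (suc r)
      ≡⟨ ring (4 ^ suc r) ⟩
    3 ℕ.* 2 ℕ.* 4 ^ suc (suc r) ∎
    where
    open ≡-Reasoning
    shape : ∀ j c → c + j * + 4 ≡ + 4 * j + c
    shape = solve-∀
    reps-k : (k ℕ.% 4 ≡ 1 ⊎ k ℕ.% 4 ≡ 2) → reps (suc (suc r)) (+ k) ≡ 3 ℕ.* 4 ^ suc r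
    reps-k (inj₁ k%4≡1) = trans (cong (reps (suc (suc r))) (trans (+-by-residue k 4 1 k%4≡1) (shape (+ (k ℕ./ 4)) (+ 1))))
                                (reps-1mod4 r (+ (k ℕ./ 4)))
    reps-k (inj₂ k%4≡2) = trans (cong (reps (suc (suc r))) (trans (+-by-residue k 4 2 k%4≡2) (shape (+ (k ℕ./ 4)) (+ 2))))
                                (reps-2mod4 r (+ (k ℕ./ 4)))
    ring : ∀ G → 2 ℕ.* 2 ℕ.* (3 ℕ.* G) ℕ.+ 3 ℕ.* (4 ℕ.* G) ≡ 3 ℕ.* 2 ℕ.* (4 ℕ.* G)
    ring = ℕ-Solver.solve-∀

  density-7mod8 : ∀ f → Equiv₂ f yz-x² → ∀ a k → k ℕ.% 8 ≡ 7 → Density₂ f (+ (4 ^ a ℕ.* k)) (+ 3 / 2)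
  density-7mod8 f f≈yz-x² a k k%8≡7 =
    closedForm⇒density-3/2 f f≈yz-x² (2 ^ a ℕ.* 1) _ _ {{ℕ.m*n≢0 (2 ^ a) 1 {{ℕ.m^n≢0 2 a}}}}
      (closedForm-4^ 1 0 k 3 (closedForm-7mod8 k k%8≡7) a)

  density-3mod8 : ∀ f → Equiv₂ f yz-x² → ∀ a k → k ℕ.% 8 ≡ 3 →
                  Density₂ f (+ (4 ^ a ℕ.* k)) (+ 3 / 2 ℚ.- _/_ (+ 1) (2 ^ (a ℕ.+ 1)) {{ℕ.m^n≢0 2 (a ℕ.+ 1)}})
  density-3mod8 f f≈yz-x² a k k%8≡3 =
    closedForm⇒density f f≈yz-x² (2 ^ a ℕ.* 1) 1 _ _ (2 ^ (a ℕ.+ 1)) {{ℕ.m^n≢0 2 (a ℕ.+ 1)}}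
      (trans (ℕ.^-distribˡ-+-* 2 a 1) (ring (2 ^ a))) (closedForm-4^ 1 1 k 3 (closedForm-3mod8 k k%8≡3) a)
    where
    ring : ∀ A → A ℕ.* (2 ℕ.* 1) ≡ 2 ℕ.* (A ℕ.* 1)
    ring = ℕ-Solver.solve-∀

  density-1or2mod4 : ∀ f → Equiv₂ f yz-x² → ∀ a k → (k ℕ.% 4 ≡ 1 ⊎ k ℕ.% 4 ≡ 2) →
                     Density₂ f (+ (4 ^ a ℕ.* k)) (+ 3 / 2 ℚ.- _/_ (+ 3) (2 ^ (a ℕ.+ 2)) {{ℕ.m^n≢0 2 (a ℕ.+ 2)}})
  density-1or2mod4 f f≈yz-x² a k k%4 =
    closedForm⇒density f f≈yz-x² (2 ^ a ℕ.* 2) 3 _ _ (2 ^ (a ℕ.+ 2)) {{ℕ.m^n≢0 2 (a ℕ.+ 2)}}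
      (trans (ℕ.^-distribˡ-+-* 2 a 2) (ring (2 ^ a))) (closedForm-4^ 2 3 k 2 (closedForm-1or2mod4 k k%4) a)
    where
    ring : ∀ A → A ℕ.* (2 ℕ.* (2 ℕ.* 1)) ≡ 2 ℕ.* (A ℕ.* 2)
    ring = ℕ-Solver.solve-∀

open Densities

open import Data.Nat using (ℕ; _^_; _*_; _%_; _<_)
open import Data.Nat.Properties using (m^n≢0)
open import Data.Nat.Divisibility using (_∣_)
open import Data.Integer using (+_)
open import Data.Rational using (ℚ; _-_; _/_)
open import Data.Product using (_×_; _,_)
open import Data.Sum using (_⊎_)
open import Relation.Nullary using (¬_)
open import Relation.Binary.PropositionalEquality using (_≡_)

theorem4p1 : ∀ (f : TForm) → Equiv₂ f yz-x² →
    ∀ (a k : ℕ) → 0 < k → ¬ (4 ∣ k) →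
      ((k % 8 ≡ 7) → Density₂ f (+ (4 ^ a * k)) (+ 3 / 2)) ×
      ((k % 8 ≡ 3) → Density₂ f (+ (4 ^ a * k))
          ((+ 3 / 2) - _/_ (+ 1) (2 ^ (a Data.Nat.+ 1)) {{m^n≢0 2 (a Data.Nat.+ 1)}})) ×
      ((k % 4 ≡ 1 ⊎ k % 4 ≡ 2) → Density₂ f (+ (4 ^ a * k))
          ((+ 3 / 2) - _/_ (+ 3) (2 ^ (a Data.Nat.+ 2)) {{m^n≢0 2 (a Data.Nat.+ 2)}}))
-- 0 < k and 4 ∤ k are implied by each of the residue conditions.
theorem4p1 f f≈yz-x² a k _ _ =
  density-7mod8 f f≈yz-x² a k , density-3mod8 f f≈yz-x² a k , density-1or2mod4 f f≈yz-x² a k
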